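{- Let $n\ge 2$ and let $D_n$ be the Coxeter group of type $D$ with Coxeter generating set $S=\{s_{1'},s_1,\ldots,s_{n-1}\}$ as described in the context. Let $J,K\subseteq S$, and let $\kappa,\nu\in\mathcal{C}(n)$ be the compositions corresponding (via the bijection in the context) to the complements $S\setminus J$ and $S\setminus K$ respectively. Then $J$ and $K$ are conjugate in $D_n$ (i.e. there is $\sigma\in D_n$ with $\sigma^{ -1}J\sigma=K$) if and only if $\kappa\approx\nu$.
   Context: For $n\ge 2$, $D_n$ is the group of permutations $\sigma$ of $\{ -n,\ldots,-1,1,\ldots,n\}$ with $\sigma(-i)=-\sigma(i)$ and an even number of negative entries among $\sigma(1),\ldots,\sigma(n)$. Its Coxeter generators are $S=\{s_{1'},s_1,\ldots,s_{n-1}\}$, where $s_i=(-i-1,\,-i)(i,\,i+1)$ for $1\le i\le n-1$ and $s_{1'}=(-2,1)(-1,2)$. A composition of $m\ge 0$ is an ordered list $\kappa=[\kappa_1,\ldots,\kappa_k]$ of positive integers summing to $m$ (with $[\ ]$ the unique composition of $0$); the $\kappa_i$ are its components. Let $\mathcal{C}(n)$ be the multiset union of: $\mathcal{C}_{<n}=\{\kappa\vDash m: m\le n-2\}$; $\mathcal{C}_1=\{\kappa\vDash n:\kappa_1=1\}$; $\mathcal{C}_n=\{\kappa\vDash n:\kappa_1\ge 2\}$; and a second copy $\mathcal{C}_n'$ of $\{\kappa\vDash n:\kappa_1\ge2\}$ (elements of $\mathcal{C}_n'$ are written $\kappa^\vee$ to distinguish them from those of $\mathcal{C}_n$). The subset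 of $S$ corresponding to $\kappa=[\kappa_1,\ldots,\kappa_k]\in\mathcal{C}(n)$ is: (1) if $\kappa\in\mathcal{C}_{<n}$ with $\kappa\vDash m$, setting $\kappa_0=n-m$: $\{s_{\kappa_0},s_{\kappa_0+\kappa_1},\ldots,s_{\kappa_0+\kappa_1+\cdots+\kappa_{k-1}}\}$; (2) if $\kappa\in\mathcal{C}_1$: $\{s_{1'},s_1,s_{1+\kappa_2},\ldots,s_{1+\kappa_2+\cdots+\kappa_{k-1}}\}$; (3) if $\kappa\in\mathcal{C}_n$: $\{s_{1'},s_{\kappa_1},\ldots,s_{\kappa_1+\cdots+\kappa_{k-1}}\}$; (4) if $\kappa\in\mathcal{C}_n'$: $\{s_1,s_{\kappa_1},\ldots,s_{\kappa_1+\cdots+\kappa_{k-1}}\}$. This is a bijection between $\mathcal{C}(n)$ and the subsets of $S$. For $\kappa,\nu\in\mathcal{C}(n)$ write $\kappa\approx\nu$ if the components of $\kappa$ can be reordered to give the components of $\nu$, and it is NOT the case that either (i) $\kappa\in\mathcal{C}_n$, $\nu\in\mathcal{C}_n'$ and all components are even, or (ii) $\kappa\in\mathcal{C}_n'$, $\nu\in\mathcal{C}_n$ and all components are even. -}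

module Defs where

open import Data.Nat using (ℕ; zero; suc; _+_; _∸_; _≤_; _<_; _≡ᵇ_; s≤s; z≤n)
open import Data.Nat.Properties using (≤-trans)
open import Data.Nat.Divisibility using (_∣_)
open import Data.Bool using (Bool; true; false; not; if_then_else_; _∨_; _∧_)
open import Data.Fin using (Fin; toℕ; fromℕ<; inject₁; _≟_)
import Data.Fin as Fin
open import Data.List using (List; []; _∷_; map; allFin; drop)
open import Data.Nat.ListAction using (sum)
open import Data.Bool.ListAction using (any)
open import Data.List.Relation.Unary.All using (All)
open import Data.List.Relation.Binary.Permutation.Propositional using (_↭_)
open import Data.Product using (Σ; _×_; _,_; proj₁; proj₂)
open import Data.Sum using (_⊎_)
open import Function.Bundles using (_↔_; Inverse)
open import Relation.Binary.PropositionalEquality using (_≡_)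
open import Relation.Nullary using (¬_; does)

-- The signed set {-n,…,-1,1,…,n}: (i , b) stands for ±(toℕ i + 1),
-- with b = true meaning the negative sign.

X : ℕ → Set
X n = Fin n × Bool

neg : ∀ {n} → X n → X n
neg (i , b) = (i , not b)

isNeg : ∀ {n} → X n → Bool
isNeg = proj₂

negCount : ∀ {n} → (X n → X n) → ℕ
negCount {n} f = sum (map (λ i → if isNeg (f (i , false)) then 1 else 0) (allFin n))

record Dn (n : ℕ) : Set where
  field
    perm   : X n ↔ X n
    oddFun : ∀ x → Inverse.to perm (neg x) ≡ neg (Inverse.to perm x)
    even   : 2 ∣ negCount (Inverse.to perm)

-- Coxeter generators S = {s_{1'}, s_1, …, s_{n-1}}.
-- `s k` (k : Fin (n ∸ 1)) denotes s_{toℕ k + 1}.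

data Gen (n : ℕ) : Set where
  s1' : Gen n
  s   : Fin (n ∸ 1) → Gen n

swapFin : ∀ {n} → Fin n → Fin n → Fin n → Fin n
swapFin a b j = if does (j ≟ a) then b else (if does (j ≟ b) then a else j)

-- the action of a generator on {±1,…,±n} (needs n ≥ 2 for s_{1'})
-- s_i = (-i-1,-i)(i,i+1) ;  s_{1'} = (-2,1)(-1,2)
genFun : ∀ {n} → 2 ≤ n → Gen n → X n → X n
genFun {n} h s1' (j , b) =
  if does (j ≟ a) then (c , not b)
  else (if does (j ≟ c) then (a , not b) else (j , b))
  where
  a : Fin n
  a = fromℕ< {0} (≤-trans (s≤s z≤n) h)
  c : Fin n
  c = fromℕ< {1} h
genFun {suc m} h (s k) (j , b) = (swapFin (inject₁ k) (Fin.suc k) j , b)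

SubsetS : ℕ → Set
SubsetS n = Gen n → Bool

complement : ∀ {n} → SubsetS n → SubsetS n
complement J g = not (J g)

-- J and K conjugate in D_n: ∃ σ ∈ D_n with σ⁻¹ J σ = K (as sets of group
-- elements; group elements compared as functions, pointwise).
conjBy : ∀ {n} → 2 ≤ n → Dn n → Gen n → X n → X n
conjBy h σ g x = Inverse.from (Dn.perm σ) (genFun h g (Inverse.to (Dn.perm σ) x))

Conjugate : ∀ {n} → 2 ≤ n → SubsetS n → SubsetS n → Set
Conjugate {n} h J K =
  Σ (Dn n) λ σ →
    (∀ g → J g ≡ true → Σ (Gen n) λ g' → K g' ≡ true × (∀ x → conjBy h σ g x ≡ genFun h g' x))
    × (∀ g' → K g' ≡ true → Σ (Gen n) λ g → J g ≡ true × (∀ x → conjBy h σ g x ≡ genFun h g' x))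

data Kind : Set where
  lessN  : Kind
  oneN   : Kind
  bigN   : Kind
  bigN'  : Kind

Positive : ℕ → Set
Positive k = 1 ≤ k

HeadIs1 : List ℕ → Set
HeadIs1 []      = 0 ≡ 1
HeadIs1 (x ∷ _) = x ≡ 1

HeadGe2 : List ℕ → Set
HeadGe2 []      = 0 ≡ 1
HeadGe2 (x ∷ _) = 2 ≤ x

Valid : ℕ → Kind → List ℕ → Set
Valid n lessN κ = All Positive κ × sum κ + 2 ≤ n
Valid n oneN  κ = All Positive κ × sum κ ≡ n × HeadIs1 κ
Valid n bigN  κ = All Positive κ × sum κ ≡ n × HeadGe2 κ
Valid n bigN' κ = All Positive κ × sum κ ≡ n × HeadGe2 κ

record Comp (n : ℕ) : Set where
  constructor comp
  field
    kind  : Kind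
    parts : List ℕ
    valid : Valid n kind parts
open Comp public

partialSums : ℕ → List ℕ → List ℕ
partialSums a []       = []
partialSums a (x ∷ xs) = a ∷ partialSums (a + x) xs

elemℕ : ℕ → List ℕ → Bool
elemℕ i = any (λ p → p ≡ᵇ i)

indices : ℕ → Kind → List ℕ → List ℕ
indices n lessN κ = partialSums (n ∸ sum κ) κ
indices n oneN  κ = drop 1 (partialSums 0 κ)
indices n bigN  κ = drop 1 (partialSums 0 κ)
indices n bigN' κ = 1 ∷ drop 1 (partialSums 0 κ)

has1' : Kind → Bool
has1' lessN = false
has1' oneN  = true
has1' bigN  = true
has1' bigN' = false

compSubset : ∀ {n} → Comp n → SubsetS n
compSubset {n} κ s1'   = has1' (kind κ)
compSubset {n} κ (s k) = elemℕ (suc (toℕ k)) (indices n (kind κ) (parts κ))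

Even : ℕ → Set
Even k = 2 ∣ k

_≈C_ : ∀ {n} → Comp n → Comp n → Set
κ ≈C ν =
  (parts κ ↭ parts ν) ×
  ¬ ((kind κ ≡ bigN × kind ν ≡ bigN' × All Even (parts κ))
     ⊎ (kind κ ≡ bigN' × kind ν ≡ bigN × All Even (parts κ)))

-- Identify D_n with the signed permutations of {±1,…,±n} having an even number of sign changes.
-- Up to the diagram automorphism ρ exchanging s_{1'} and s_1, which conjugation by the (odd) sign
-- change τ of 1 realises, the complement of the subset attached to κ is a standard subset: the
-- adjacent transpositions inside consecutive blocks of positions of sizes κ₁, κ₂, …, together with
-- s_{1'} and the transpositions of an initial block of size n - |κ| when κ ∈ 𝒞_{<n}.
-- A relabelling of positions permuting the blocks is an even element conjugating two standard
-- subsets with the same block sizes.  Changing the twist by ρ needs an odd element commuting with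
-- the standard subset: the sign change of a whole block of odd size, available unless all blocks
-- are even.  Conversely, a conjugating signed permutation sends blocks onto blocks, the initial one
-- onto the initial one, so block sizes agree as multisets; and if all blocks are even and s_{1'} is
-- absent, its sign changes are constant on blocks, so it is even and cannot change the twist.

module Submission where

open import Defs
open import Algebra.Bundles using (CommutativeRing)
import Algebra.Properties.CommutativeMonoid.Sum as CommutativeMonoidSum
open import Data.Bool using (Bool; true; false; not; if_then_else_; _xor_)
open import Data.Bool.Properties
  using (not-involutive; not-¬; xor-assoc; xor-comm; xor-same; xor-identityʳ; not-distribˡ-xor; xor-∧-commutativeRing)
open import Data.Empty using (⊥; ⊥-elim)
open import Data.Fin using (Fin; toℕ; fromℕ<; inject₁; _≟_)
import Data.Fin as Fin
import Data.Fin.Properties as Finₚ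
open import Data.Fin.Permutation using (Permutation′; permutation; flip; _⟨$⟩ʳ_; _⟨$⟩ˡ_; inverseˡ; inverseʳ)
open import Data.List using (List; []; _∷_; _++_; length; map; allFin; tabulate)
open import Data.List.Properties using (++-assoc; map-tabulate)
open import Data.List.Relation.Binary.Permutation.Propositional
  using (_↭_; ↭-sym; prep; swap) renaming (refl to ↭-refl; trans to ↭-trans)
open import Data.List.Relation.Binary.Permutation.Propositional.Properties using (All-resp-↭; shift; ++⁺ˡ)
open import Data.List.Relation.Unary.All using (All; []; _∷_)
open import Data.List.Relation.Unary.All.Properties using (++⁻ʳ)
open import Data.Nat
  using (ℕ; zero; suc; _+_; _*_; _∸_; _≤_; _<_; _≤ᵇ_; _≡ᵇ_; s≤s; z≤n)
open import Data.Nat.Divisibility using (_∣_; divides; ∣m⇒∣m*n)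
open import Data.Nat.DivMod using (_mod_; m<n⇒m%n≡m)
open import Data.Nat.ListAction using (sum)
open import Data.Nat.ListAction.Properties using (sum-++; sum-↭)
open import Data.Nat.Properties renaming (_≟_ to _≟ℕ_)
open import Algebra.Properties.CommutativeSemigroup +-commutativeSemigroup using (x∙yz≈y∙xz; xy∙z≈xz∙y)
open import Data.Product using (Σ; _×_; _,_; proj₁; proj₂)
open import Data.Sum using (_⊎_; inj₁; inj₂; [_,_]′)
open import Function using (_∘_; id)
open import Function.Bundles using (Inverse; Equivalence; _⇔_; mk⇔; mk↔ₛ′)
open import Function.Construct.Composition using (_⇔-∘_)
open import Relation.Binary.Definitions using (tri<; tri≈; tri>)
open import Relation.Binary.PropositionalEquality
open import Relation.Nullary using (¬_; Dec; yes; no; does)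
open import Relation.Nullary.Decidable using (dec-true; dec-false; does-⇔)

module ℕΣ = CommutativeMonoidSum +-0-commutativeMonoid
module ⊕Σ = CommutativeMonoidSum (CommutativeRing.+-commutativeMonoid xor-∧-commutativeRing)

bool→ℕ : Bool → ℕ
bool→ℕ b = if b then 1 else 0

parity : ℕ → Bool
parity zero    = false
parity (suc n) = not (parity n)

parity-+ : ∀ m n → parity (m + n) ≡ parity m xor parity n
parity-+ zero    n = refl
parity-+ (suc m) n = trans (cong not (parity-+ m n)) (not-distribˡ-xor (parity m) (parity n))

parity-*2 : ∀ q → parity (q * 2) ≡ false
parity-*2 zero    = refl
parity-*2 (suc q) = trans (not-involutive _) (parity-*2 q)

even⇒parity≡false : ∀ {n} → 2 ∣ n → parity n ≡ false
even⇒parity≡false (divides q refl) = parity-*2 q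

parity≡false⇒even : ∀ n → parity n ≡ false → 2 ∣ n
parity≡false⇒even zero          _ = divides 0 refl
parity≡false⇒even (suc (suc n)) e with parity≡false⇒even n (trans (sym (not-involutive _)) e)
... | divides q eq = divides (suc q) (cong (suc ∘ suc) eq)

parity-∑ : ∀ {n} (f : Fin n → Bool) → parity (ℕΣ.sum (bool→ℕ ∘ f)) ≡ ⊕Σ.sum f
parity-∑ {zero}  f = refl
parity-∑ {suc n} f = trans (parity-+ (bool→ℕ (f Fin.zero)) _)
  (cong₂ _xor_ (parity-bool→ℕ (f Fin.zero)) (parity-∑ (f ∘ Fin.suc)))
  where
  parity-bool→ℕ : ∀ b → parity (bool→ℕ b) ≡ b
  parity-bool→ℕ true  = refl
  parity-bool→ℕ false = refl

sum-map-allFin : ∀ {n} (g : Fin n → ℕ) → sum (map g (allFin n)) ≡ ℕΣ.sum g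
sum-map-allFin g = trans (cong sum (map-tabulate id g)) (sum-tabulate g)
  where
  sum-tabulate : ∀ {n} (g : Fin n → ℕ) → sum (tabulate g) ≡ ℕΣ.sum g
  sum-tabulate {zero}  g = refl
  sum-tabulate {suc n} g = cong (g Fin.zero +_) (sum-tabulate (g ∘ Fin.suc))

xor-cancelʳ : ∀ a b → (a xor b) xor b ≡ a
xor-cancelʳ a b = trans (xor-assoc a b b) (trans (cong (a xor_) (xor-same b)) (xor-identityʳ a))

xor≡false⇒≡ : ∀ {a b} → a xor b ≡ false → a ≡ b
xor≡false⇒≡ {false} e = sym e
xor≡false⇒≡ {true}  e = sym (trans (sym (not-involutive _)) (cong not e))

-- Signed permutations

record SignedPerm (n : ℕ) : Set where
  field
    to      : X n → X n
    from    : X n → X n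
    from-to : ∀ x → from (to x) ≡ x
    to-from : ∀ y → to (from y) ≡ y
    to-neg  : ∀ x → to (neg x) ≡ neg (to x)

  from-neg : ∀ y → from (neg y) ≡ neg (from y)
  from-neg y = begin
    from (neg y)             ≡⟨ cong (from ∘ neg) (sym (to-from y)) ⟩
    from (neg (to (from y))) ≡⟨ cong from (sym (to-neg (from y))) ⟩
    from (to (neg (from y))) ≡⟨ from-to _ ⟩
    neg (from y)             ∎
    where open ≡-Reasoning

  position : Fin n → Fin n
  position i = proj₁ (to (i , false))

  sign : Fin n → Bool
  sign i = isNeg (to (i , false))

  to-pair : ∀ i b → to (i , b) ≡ (position i , sign i xor b)
  to-pair i false = cong (position i ,_) (sym (xor-identityʳ (sign i)))
  to-pair i true  = trans (to-neg (i , false)) (cong (position i ,_) (xor-comm true (sign i)))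

open SignedPerm public

inverse : ∀ {n} → SignedPerm n → SignedPerm n
inverse σ = record
  { to = from σ ; from = to σ ; from-to = to-from σ ; to-from = from-to σ ; to-neg = from-neg σ }

_∘ₛ_ : ∀ {n} → SignedPerm n → SignedPerm n → SignedPerm n
σ ∘ₛ τ = record
  { to      = to σ ∘ to τ
  ; from    = from τ ∘ from σ
  ; from-to = λ x → trans (cong (from τ) (from-to σ _)) (from-to τ x)
  ; to-from = λ y → trans (cong (to σ) (to-from τ _)) (to-from σ y)
  ; to-neg  = λ x → trans (cong (to σ) (to-neg τ x)) (to-neg σ _)
  }

idₛ : ∀ {n} → SignedPerm n
idₛ = record { to = id ; from = id ; from-to = λ _ → refl ; to-from = λ _ → refl ; to-neg = λ _ → refl }

position-inverse : ∀ {n} (σ : SignedPerm n) i → position (inverse σ) (position σ i) ≡ i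
position-inverse σ i = cong proj₁ (begin
  from σ (position σ i , false)                     ≡⟨ cong (from σ ∘ (position σ i ,_)) (sym (xor-same (sign σ i))) ⟩
  from σ (position σ i , sign σ i xor sign σ i)     ≡⟨ cong (from σ) (sym (to-pair σ i (sign σ i))) ⟩
  from σ (to σ (i , sign σ i))                      ≡⟨ from-to σ _ ⟩
  (i , sign σ i)                                    ∎)
  where open ≡-Reasoning

positionPerm : ∀ {n} → SignedPerm n → Permutation′ n
positionPerm σ = permutation (position σ) (position (inverse σ))
  (position-inverse (inverse σ)) (position-inverse σ)

signParity : ∀ {n} → SignedPerm n → Bool
signParity σ = ⊕Σ.sum (sign σ)

signParity-∘ : ∀ {n} (σ τ : SignedPerm n) → signParity (σ ∘ₛ τ) ≡ signParity σ xor signParity τ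
signParity-∘ σ τ = begin
  ⊕Σ.sum (sign (σ ∘ₛ τ))                          ≡⟨ ⊕Σ.sum-cong-≗ sign-∘ ⟩
  ⊕Σ.sum (λ i → sign σ (position τ i) xor sign τ i) ≡⟨ ⊕Σ.∑-distrib-+ (sign σ ∘ position τ) (sign τ) ⟩
  ⊕Σ.sum (sign σ ∘ position τ) xor signParity τ   ≡⟨ cong (_xor signParity τ) (sym (⊕Σ.∑-permute (sign σ) (positionPerm τ))) ⟩
  signParity σ xor signParity τ                   ∎
  where
  open ≡-Reasoning
  sign-∘ : ∀ i → sign (σ ∘ₛ τ) i ≡ sign σ (position τ i) xor sign τ i
  sign-∘ i = trans (cong (isNeg ∘ to σ) (to-pair τ i false))
    (trans (cong isNeg (to-pair σ (position τ i) _)) (cong (sign σ (position τ i) xor_) (xor-identityʳ (sign τ i))))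

signParity-unsigned : ∀ {n} (σ : SignedPerm n) → (∀ i → sign σ i ≡ false) → signParity σ ≡ false
signParity-unsigned {n} σ unsigned = trans (⊕Σ.sum-cong-≗ unsigned) (⊕Σ.sum-replicate-zero n)

signParity-inverse : ∀ {n} (σ : SignedPerm n) → signParity (inverse σ) ≡ signParity σ
signParity-inverse σ = sym (xor≡false⇒≡ (trans (sym (signParity-∘ σ (inverse σ)))
  (signParity-unsigned (σ ∘ₛ inverse σ) (λ i → cong proj₂ (to-from σ (i , false))))))

flipSigns : ∀ {n} → (Fin n → Bool) → SignedPerm n
flipSigns ε = record
  { to      = flipAt
  ; from    = flipAt
  ; from-to = λ (i , b) → cong (i ,_) (xor-cancelʳ b (ε i))
  ; to-from = λ (i , b) → cong (i ,_) (xor-cancelʳ b (ε i))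
  ; to-neg  = λ (i , b) → cong (i ,_) (sym (not-distribˡ-xor b (ε i)))
  }
  where
  flipAt : X _ → X _
  flipAt (i , b) = (i , b xor ε i)

permutePositions : ∀ {n} → Permutation′ n → SignedPerm n
permutePositions π = record
  { to      = λ (i , b) → (π ⟨$⟩ʳ i , b)
  ; from    = λ (i , b) → (π ⟨$⟩ˡ i , b)
  ; from-to = λ (i , b) → cong (_, b) (inverseˡ π)
  ; to-from = λ (i , b) → cong (_, b) (inverseʳ π)
  ; to-neg  = λ _ → refl
  }

signParity-permutePositions : ∀ {n} (π : Permutation′ n) → signParity (permutePositions π) ≡ false
signParity-permutePositions π = signParity-unsigned (permutePositions π) (λ _ → refl)

toSigned : ∀ {n} → Dn n → SignedPerm n
toSigned σ = record
  { to      = Inverse.to (Dn.perm σ)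
  ; from    = Inverse.from (Dn.perm σ)
  ; from-to = λ _ → Inverse.inverseʳ (Dn.perm σ) refl
  ; to-from = λ _ → Inverse.inverseˡ (Dn.perm σ) refl
  ; to-neg  = Dn.oddFun σ
  }

parity-negCount : ∀ {n} (σ : SignedPerm n) → parity (negCount (to σ)) ≡ signParity σ
parity-negCount σ = trans (cong parity (sum-map-allFin (bool→ℕ ∘ sign σ))) (parity-∑ (sign σ))

signParity-toSigned : ∀ {n} (σ : Dn n) → signParity (toSigned σ) ≡ false
signParity-toSigned σ = trans (sym (parity-negCount (toSigned σ))) (even⇒parity≡false (Dn.even σ))

fromSigned : ∀ {n} (σ : SignedPerm n) → signParity σ ≡ false → Dn n
fromSigned σ even = record
  { perm   = mk↔ₛ′ (to σ) (from σ) (to-from σ) (from-to σ)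
  ; oddFun = to-neg σ
  ; even   = parity≡false⇒even _ (trans (parity-negCount σ) even)
  }

Conjugates : ∀ {n} → 2 ≤ n → SignedPerm n → Gen n → Gen n → Set
Conjugates h σ g g′ = ∀ x → from σ (genFun h g (to σ x)) ≡ genFun h g′ x

conjugates-inverse : ∀ {n} (h : 2 ≤ n) σ {g g′} → Conjugates h σ g g′ → Conjugates h (inverse σ) g′ g
conjugates-inverse h σ {g} conj x =
  trans (cong (to σ) (sym (conj (from σ x)))) (trans (to-from σ _) (cong (genFun h g) (to-from σ x)))

conjugates⇒commutes : ∀ {n} (h : 2 ≤ n) σ {g g′} → Conjugates h σ g g′ →
                      ∀ x → to σ (genFun h g′ x) ≡ genFun h g (to σ x)
conjugates⇒commutes h σ conj x = trans (cong (to σ) (sym (conj x))) (to-from σ _)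

Intertwines : ∀ {n} → 2 ≤ n → SignedPerm n → SubsetS n → SubsetS n → Set
Intertwines {n} h σ J K =
  (∀ g → J g ≡ true → Σ (Gen n) λ g′ → K g′ ≡ true × Conjugates h σ g g′) ×
  (∀ g′ → K g′ ≡ true → Σ (Gen n) λ g → J g ≡ true × Conjugates h σ g g′)

intertwines-commuting : ∀ {n} (h : 2 ≤ n) σ {J} → (∀ g → J g ≡ true → Conjugates h σ g g) → Intertwines h σ J J
intertwines-commuting h σ commutes = (λ g Jg → g , Jg , commutes g Jg) , (λ g Jg → g , Jg , commutes g Jg)

intertwines-id : ∀ {n} (h : 2 ≤ n) J → Intertwines h idₛ J J
intertwines-id h J = intertwines-commuting h idₛ (λ _ _ _ → refl)

intertwines-∘ : ∀ {n} (h : 2 ≤ n) σ τ {J K M : SubsetS n} →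
                Intertwines h σ J K → Intertwines h τ K M → Intertwines h (σ ∘ₛ τ) J M
intertwines-∘ h σ τ (σ→ , σ←) (τ→ , τ←) =
  (λ g Jg → let (g′ , Kg′ , c) = σ→ g Jg ; (g″ , Mg″ , d) = τ→ g′ Kg′ in g″ , Mg″ , compose {g} {g′} {g″} c d) ,
  (λ g″ Mg″ → let (g′ , Kg′ , d) = τ← g″ Mg″ ; (g , Jg , c) = σ← g′ Kg′ in g , Jg , compose {g} {g′} {g″} c d)
  where
  compose : ∀ {g g′ g″} → Conjugates h σ g g′ → Conjugates h τ g′ g″ → Conjugates h (σ ∘ₛ τ) g g″
  compose c d x = trans (cong (from τ) (c (to τ x))) (d x)

intertwines-inverse : ∀ {n} (h : 2 ≤ n) σ {J K : SubsetS n} → Intertwines h σ J K → Intertwines h (inverse σ) K J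
intertwines-inverse h σ (σ→ , σ←) =
  (λ g′ Kg′ → let (g , Jg , c) = σ← g′ Kg′ in g , Jg , conjugates-inverse h σ {g} {g′} c) ,
  (λ g Jg → let (g′ , Kg′ , c) = σ→ g Jg in g′ , Kg′ , conjugates-inverse h σ {g} {g′} c)

intertwines-cong : ∀ {n} (h : 2 ≤ n) σ {J J′ K K′ : SubsetS n} → (∀ g → J g ≡ J′ g) → (∀ g → K g ≡ K′ g) →
                   Intertwines h σ J K → Intertwines h σ J′ K′
intertwines-cong h σ J≗J′ K≗K′ (σ→ , σ←) =
  (λ g J′g → let (g′ , Kg′ , c) = σ→ g (trans (J≗J′ g) J′g) in g′ , trans (sym (K≗K′ g′)) Kg′ , c) ,
  (λ g′ K′g′ → let (g , Jg , c) = σ← g′ (trans (K≗K′ g′) K′g′) in g , trans (sym (J≗J′ g)) Jg , c)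

SignedConjugate : ∀ {n} → 2 ≤ n → SubsetS n → SubsetS n → Set
SignedConjugate {n} h J K = Σ (SignedPerm n) λ σ → signParity σ ≡ false × Intertwines h σ J K

signedConjugate-refl : ∀ {n} (h : 2 ≤ n) J → SignedConjugate h J J
signedConjugate-refl {n} h J = idₛ , signParity-unsigned (idₛ {n}) (λ _ → refl) , intertwines-id h J

signedConjugate-sym : ∀ {n} (h : 2 ≤ n) {J K} → SignedConjugate h J K → SignedConjugate h K J
signedConjugate-sym h (σ , even , i) = inverse σ , trans (signParity-inverse σ) even , intertwines-inverse h σ i

signedConjugate-trans : ∀ {n} (h : 2 ≤ n) {J K M} → SignedConjugate h J K → SignedConjugate h K M → SignedConjugate h J M
signedConjugate-trans h (σ , σ-even , i) (τ , τ-even , j) =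
  σ ∘ₛ τ , trans (signParity-∘ σ τ) (cong₂ _xor_ σ-even τ-even) , intertwines-∘ h σ τ i j

conjugate⇔signedConjugate : ∀ {n} (h : 2 ≤ n) {J K} → Conjugate h J K ⇔ SignedConjugate h J K
conjugate⇔signedConjugate h = mk⇔
  (λ (σ , i) → toSigned σ , signParity-toSigned σ , i)
  (λ (σ , even , i) → fromSigned σ even , i)

swapFin-left : ∀ {k} {a b j : Fin k} → j ≡ a → swapFin a b j ≡ b
swapFin-left {a = a} {j = j} j≡a with j ≟ a
... | yes _   = refl
... | no j≢a  = ⊥-elim (j≢a j≡a)

swapFin-right : ∀ {k} {a b j : Fin k} → j ≢ a → j ≡ b → swapFin a b j ≡ a
swapFin-right {a = a} {b} {j} j≢a j≡b with j ≟ a | j ≟ b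
... | yes j≡a | _      = ⊥-elim (j≢a j≡a)
... | no _    | yes _  = refl
... | no _    | no j≢b = ⊥-elim (j≢b j≡b)

swapFin-other : ∀ {k} {a b j : Fin k} → j ≢ a → j ≢ b → swapFin a b j ≡ j
swapFin-other {a = a} {b} {j} j≢a j≢b with j ≟ a | j ≟ b
... | yes j≡a | _       = ⊥-elim (j≢a j≡a)
... | no _    | yes j≡b = ⊥-elim (j≢b j≡b)
... | no _    | no _    = refl

swapFin-invariant : ∀ {k} {A : Set} (f : Fin k → A) {a b} → f a ≡ f b → ∀ j → f (swapFin a b j) ≡ f j
swapFin-invariant f {a} {b} fa≡fb j = go (j ≟ a) (j ≟ b)
  where
  go : Dec (j ≡ a) → Dec (j ≡ b) → f (swapFin a b j) ≡ f j
  go (yes j≡a) _         = trans (cong f (swapFin-left j≡a)) (trans (sym fa≡fb) (cong f (sym j≡a)))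
  go (no j≢a)  (yes j≡b) = trans (cong f (swapFin-right j≢a j≡b)) (trans fa≡fb (cong f (sym j≡b)))
  go (no j≢a)  (no j≢b)  = cong f (swapFin-other j≢a j≢b)

swapFin-conjugate : ∀ {k} (π : Permutation′ k) a b j →
  π ⟨$⟩ˡ swapFin a b (π ⟨$⟩ʳ j) ≡ swapFin (π ⟨$⟩ˡ a) (π ⟨$⟩ˡ b) j
swapFin-conjugate π a b j = go (π ⟨$⟩ʳ j ≟ a) (π ⟨$⟩ʳ j ≟ b)
  where
  pull : ∀ {c} → π ⟨$⟩ʳ j ≡ c → j ≡ π ⟨$⟩ˡ c
  pull eq = trans (sym (inverseˡ π)) (cong (π ⟨$⟩ˡ_) eq)
  push : ∀ {c} → π ⟨$⟩ʳ j ≢ c → j ≢ π ⟨$⟩ˡ c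
  push ne eq = ne (trans (cong (π ⟨$⟩ʳ_) eq) (inverseʳ π))
  go : Dec (π ⟨$⟩ʳ j ≡ a) → Dec (π ⟨$⟩ʳ j ≡ b) → π ⟨$⟩ˡ swapFin a b (π ⟨$⟩ʳ j) ≡ swapFin (π ⟨$⟩ˡ a) (π ⟨$⟩ˡ b) j
  go (yes πj≡a) _          = trans (cong (π ⟨$⟩ˡ_) (swapFin-left πj≡a)) (sym (swapFin-left (pull πj≡a)))
  go (no πj≢a)  (yes πj≡b) = trans (cong (π ⟨$⟩ˡ_) (swapFin-right πj≢a πj≡b)) (sym (swapFin-right (push πj≢a) (pull πj≡b)))
  go (no πj≢a)  (no πj≢b)  =
    trans (cong (π ⟨$⟩ˡ_) (swapFin-other πj≢a πj≢b)) (trans (inverseˡ π) (sym (swapFin-other (push πj≢a) (push πj≢b))))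

-- Blocks of a composition

-- Positions are 0-based: position t stands for the element t + 1.  Positions t < b form block 0
-- and the following ones are cut into consecutive blocks of sizes L; blockIndex b L t is the block of t.

δ : ℕ → ℕ → ℕ
δ v w = bool→ℕ (v ≡ᵇ w)

δ-refl : ∀ v → δ v v ≡ 1
δ-refl v = cong bool→ℕ (dec-true (v ≟ℕ v) refl)

δ-≢ : ∀ {v w} → v ≢ w → δ v w ≡ 0
δ-≢ {v} {w} v≢w = cong bool→ℕ (dec-false (v ≟ℕ w) v≢w)

occurrences : ℕ → List ℕ → ℕ
occurrences v []       = 0
occurrences v (c ∷ cs) = δ c v + occurrences v cs

occurrences≡0⇔∉ : ∀ v cs → occurrences v cs ≡ 0 ⇔ elemℕ v cs ≡ false
occurrences≡0⇔∉ v cs = mk⇔ (⇒ cs) (⇐ cs)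
  where
  ⇒ : ∀ cs → occurrences v cs ≡ 0 → elemℕ v cs ≡ false
  ⇒ []       _ = refl
  ⇒ (c ∷ cs) e with c ≡ᵇ v
  ... | false = ⇒ cs e
  ⇐ : ∀ cs → elemℕ v cs ≡ false → occurrences v cs ≡ 0
  ⇐ []       _ = refl
  ⇐ (c ∷ cs) e with c ≡ᵇ v
  ... | false = ⇐ cs e

≤ᵇ-true : ∀ {b t} → b ≤ t → (b ≤ᵇ t) ≡ true
≤ᵇ-true {b} {t} = dec-true (b ≤? t)

≤ᵇ-false : ∀ {b t} → t < b → (b ≤ᵇ t) ≡ false
≤ᵇ-false {b} {t} t<b = dec-false (b ≤? t) (<⇒≱ t<b)

blockIndex : ℕ → List ℕ → ℕ → ℕ
blockIndex b []       t = 0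
blockIndex b (x ∷ xs) t = bool→ℕ (b ≤ᵇ t) + blockIndex (b + x) xs t

blockIndex-below : ∀ b L {t} → t < b → blockIndex b L t ≡ 0
blockIndex-below b []       t<b = refl
blockIndex-below b (x ∷ xs) t<b rewrite ≤ᵇ-false t<b = blockIndex-below (b + x) xs (≤-trans t<b (m≤m+n b x))

blockIndex-above : ∀ b L {t} → b + sum L ≤ t → blockIndex b L t ≡ length L
blockIndex-above b []       _ = refl
blockIndex-above b (x ∷ xs) {t} p rewrite ≤ᵇ-true (≤-trans (m≤m+n b (x + sum xs)) p) =
  cong suc (blockIndex-above (b + x) xs (subst (_≤ t) (sym (+-assoc b x (sum xs))) p))

blockIndex-start≡0 : ∀ u R → blockIndex u R u ≡ 0 → R ≡ []
blockIndex-start≡0 u []       _ = refl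
blockIndex-start≡0 u (x ∷ xs) e rewrite ≤ᵇ-true (≤-refl {u}) = ⊥-elim (1+n≢0 e)

blockIndex-≤length : ∀ b L t → blockIndex b L t ≤ length L
blockIndex-≤length b []       t = z≤n
blockIndex-≤length b (x ∷ xs) t with b ≤ᵇ t
... | true  = s≤s (blockIndex-≤length (b + x) xs t)
... | false = m≤n⇒m≤1+n (blockIndex-≤length (b + x) xs t)

blockIndex-++ : ∀ b P Q t → blockIndex b (P ++ Q) t ≡ blockIndex b P t + blockIndex (b + sum P) Q t
blockIndex-++ b []      Q t = cong (λ c → blockIndex c Q t) (sym (+-identityʳ b))
blockIndex-++ b (x ∷ P) Q t = begin
  i + blockIndex (b + x) (P ++ Q) t                             ≡⟨ cong (i +_) (blockIndex-++ (b + x) P Q t) ⟩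
  i + (blockIndex (b + x) P t + blockIndex (b + x + sum P) Q t) ≡⟨ sym (+-assoc i _ _) ⟩
  i + blockIndex (b + x) P t + blockIndex (b + x + sum P) Q t   ≡⟨ cong (λ c → i + blockIndex (b + x) P t + blockIndex c Q t) (+-assoc b x (sum P)) ⟩
  i + blockIndex (b + x) P t + blockIndex (b + (x + sum P)) Q t ∎
  where
  open ≡-Reasoning
  i : ℕ
  i = bool→ℕ (b ≤ᵇ t)

blockIndex-suc : ∀ b L k → blockIndex b L (suc k) ≡ blockIndex b L k + occurrences (suc k) (partialSums b L)
blockIndex-suc b []       k = refl
blockIndex-suc b (x ∷ xs) k = begin
  bool→ℕ (b ≤ᵇ suc k) + blockIndex (b + x) xs (suc k) ≡⟨ cong₂ _+_ (start-suc b k) (blockIndex-suc (b + x) xs k) ⟩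
  (i + δ b (suc k)) + (j + o)                         ≡⟨ +-assoc i _ _ ⟩
  i + (δ b (suc k) + (j + o))                         ≡⟨ cong (i +_) (x∙yz≈y∙xz (δ b (suc k)) j o) ⟩
  i + (j + (δ b (suc k) + o))                         ≡⟨ sym (+-assoc i j _) ⟩
  i + j + (δ b (suc k) + o)                           ∎
  where
  open ≡-Reasoning
  i : ℕ
  i = bool→ℕ (b ≤ᵇ k)
  j : ℕ
  j = blockIndex (b + x) xs k
  o : ℕ
  o = occurrences (suc k) (partialSums (b + x) xs)
  start-suc : ∀ b k → bool→ℕ (b ≤ᵇ suc k) ≡ bool→ℕ (b ≤ᵇ k) + δ b (suc k)
  start-suc b k with <-cmp b (suc k)
  ... | tri< b<1+k b≢1+k _ rewrite ≤ᵇ-true (≤-pred b<1+k) | ≤ᵇ-true (<⇒≤ b<1+k) | dec-false (b ≟ℕ suc k) b≢1+k = refl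
  ... | tri≈ _ refl _ rewrite ≤ᵇ-false (n<1+n k) | dec-true (suc k ≟ℕ suc k) refl | ≤ᵇ-true (≤-refl {suc k}) = refl
  ... | tri> _ b≢1+k 1+k<b rewrite ≤ᵇ-false 1+k<b | ≤ᵇ-false (<-trans (n<1+n k) 1+k<b) | dec-false (b ≟ℕ suc k) b≢1+k = refl

sameBlock⇔notCut : ∀ b L k →
  blockIndex b L k ≡ blockIndex b L (suc k) ⇔ elemℕ (suc k) (partialSums b L) ≡ false
sameBlock⇔notCut b L k = mk⇔
  (λ same → Equivalence.to (occurrences≡0⇔∉ (suc k) (partialSums b L)) (+-cancelˡ-≡ (blockIndex b L k) _ 0
     (trans (sym (blockIndex-suc b L k)) (trans (sym same) (sym (+-identityʳ _))))))
  (λ notCut → sym (trans (blockIndex-suc b L k)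
     (trans (cong (blockIndex b L k +_) (Equivalence.from (occurrences≡0⇔∉ (suc k) (partialSums b L)) notCut)) (+-identityʳ _))))

blockIndex-mono : ∀ b L {t u} → t ≤ u → blockIndex b L t ≤ blockIndex b L u
blockIndex-mono b L {t} t≤u with m≤n⇒∃[o]m+o≡n t≤u
... | d , refl = go d
  where
  go : ∀ d → blockIndex b L t ≤ blockIndex b L (t + d)
  go zero    rewrite +-identityʳ t = ≤-refl
  go (suc d) rewrite +-suc t d | blockIndex-suc b L (t + d) = ≤-trans (go d) (m≤m+n _ _)

sameBlock-constant : ∀ {n} {A : Set} b L (f : ℕ → A) →
  (∀ k → suc k < n → blockIndex b L k ≡ blockIndex b L (suc k) → f k ≡ f (suc k)) →
  ∀ {t u} → t < n → u < n → blockIndex b L t ≡ blockIndex b L u → f t ≡ f u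
sameBlock-constant {n} b L f step {t} {u} t<n u<n same =
  [ (λ t≤u → ordered t≤u u<n same) , (λ u≤t → sym (ordered u≤t t<n (sym same))) ]′ (≤-total t u)
  where
  I : ℕ → ℕ
  I = blockIndex b L
  upward : ∀ d t → t + d < n → I t ≡ I (t + d) → f t ≡ f (t + d)
  upward zero    t _     _     = cong f (sym (+-identityʳ t))
  upward (suc d) t t+d′<n same′ =
    trans (upward d t (<-trans (n<1+n (t + d)) t+d+1<n) I≡)
      (trans (step (t + d) t+d+1<n (trans (sym I≡) (sym top))) (cong f (sym (+-suc t d))))
    where
    t+d+1<n : suc (t + d) < n
    t+d+1<n = subst (_< n) (+-suc t d) t+d′<n
    top : I (suc (t + d)) ≡ I t
    top = trans (cong I (sym (+-suc t d))) (sym same′)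
    I≡ : I t ≡ I (t + d)
    I≡ = ≤-antisym (blockIndex-mono b L (m≤m+n t d)) (subst (I (t + d) ≤_) top (blockIndex-mono b L (n≤1+n (t + d))))
  ordered : ∀ {t u} → t ≤ u → u < n → I t ≡ I u → f t ≡ f u
  ordered {t} t≤u u<n same with m≤n⇒∃[o]m+o≡n t≤u
  ... | d , refl = upward d t u<n same

rangeSum : ℕ → ℕ → (ℕ → ℕ) → ℕ
rangeSum a zero    ψ = 0
rangeSum a (suc m) ψ = ψ a + rangeSum (suc a) m ψ

rangeSum-+ : ∀ a m k ψ → rangeSum a (m + k) ψ ≡ rangeSum a m ψ + rangeSum (a + m) k ψ
rangeSum-+ a zero    k ψ = cong (λ c → rangeSum c k ψ) (sym (+-identityʳ a))
rangeSum-+ a (suc m) k ψ = trans (cong (ψ a +_) (trans (rangeSum-+ (suc a) m k ψ)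
  (cong (λ c → rangeSum (suc a) m ψ + rangeSum c k ψ) (sym (+-suc a m))))) (sym (+-assoc (ψ a) _ _))

rangeSum-constant : ∀ a m ψ → (∀ k → a ≤ k → suc k < a + m → ψ k ≡ ψ (suc k)) → rangeSum a m ψ ≡ m * ψ a
rangeSum-constant a zero          ψ step = refl
rangeSum-constant a (suc zero)    ψ step = refl
rangeSum-constant a (suc (suc m)) ψ step = cong (ψ a +_) (trans
  (rangeSum-constant (suc a) (suc m) ψ (λ k a<k k+1<end → step k (<⇒≤ a<k) (reindex k+1<end)))
  (cong (suc m *_) (sym (step a ≤-refl (reindex (s≤s (m<m+n a (s≤s z≤n))))))))
  where
  reindex : ∀ {t} → t < suc a + suc m → t < a + suc (suc m)
  reindex {t} = subst (t <_) (sym (+-suc a (suc m)))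

∑≡rangeSum : ∀ n (φ : ℕ → ℕ) → ℕΣ.sum {n} (φ ∘ toℕ) ≡ rangeSum 0 n φ
∑≡rangeSum n φ = trans (ℕΣ.sum-cong-≗ {n} (λ i → cong φ (sym (+-identityʳ (toℕ i))))) (shifted n 0)
  where
  shifted : ∀ n a → ℕΣ.sum {n} (λ i → φ (toℕ i + a)) ≡ rangeSum a n φ
  shifted zero    a = refl
  shifted (suc n) a = cong (φ a +_)
    (trans (ℕΣ.sum-cong-≗ {n} (λ i → cong φ (sym (+-suc (toℕ i) a)))) (shifted n (suc a)))

blockSum : (ℕ → ℕ) → ℕ → List ℕ → ℕ
blockSum ψ b []       = 0
blockSum ψ b (x ∷ xs) = x * ψ b + blockSum ψ (b + x) xs

blockSum-cong : ∀ b L {ψ ψ′} → (∀ t → b ≤ t → ψ t ≡ ψ′ t) → blockSum ψ b L ≡ blockSum ψ′ b L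
blockSum-cong b []       eq = refl
blockSum-cong b (x ∷ xs) eq =
  cong₂ _+_ (cong (x *_) (eq b ≤-refl)) (blockSum-cong (b + x) xs (λ t b+x≤t → eq t (≤-trans (m≤m+n b x) b+x≤t)))

rangeSum-blocks : ∀ a b L ψ → a ≤ b →
  (∀ k → a ≤ k → suc k < b + sum L → blockIndex b L k ≡ blockIndex b L (suc k) → ψ k ≡ ψ (suc k)) →
  rangeSum a ((b ∸ a) + sum L) ψ ≡ (b ∸ a) * ψ a + blockSum ψ b L
rangeSum-blocks a b [] ψ a≤b step = begin
  rangeSum a ((b ∸ a) + 0) ψ ≡⟨ cong (λ c → rangeSum a c ψ) (+-identityʳ (b ∸ a)) ⟩
  rangeSum a (b ∸ a) ψ       ≡⟨ rangeSum-constant a (b ∸ a) ψ (λ k a≤k k+1<b → step k a≤k (bound k+1<b) refl) ⟩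
  (b ∸ a) * ψ a              ≡⟨ sym (+-identityʳ _) ⟩
  (b ∸ a) * ψ a + 0          ∎
  where
  open ≡-Reasoning
  bound : ∀ {t} → t < a + (b ∸ a) → t < b + 0
  bound {t} = subst (t <_) (trans (m+[n∸m]≡n a≤b) (sym (+-identityʳ b)))
rangeSum-blocks a b (x ∷ xs) ψ a≤b step = begin
  rangeSum a ((b ∸ a) + (x + sum xs)) ψ                        ≡⟨ rangeSum-+ a (b ∸ a) _ ψ ⟩
  rangeSum a (b ∸ a) ψ + rangeSum (a + (b ∸ a)) (x + sum xs) ψ ≡⟨ cong₂ _+_ block₀ rest ⟩
  (b ∸ a) * ψ a + rangeSum b (((b + x) ∸ b) + sum xs) ψ        ≡⟨ cong ((b ∸ a) * ψ a +_) (rangeSum-blocks b (b + x) xs ψ (m≤m+n b x) step′) ⟩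
  (b ∸ a) * ψ a + (((b + x) ∸ b) * ψ b + blockSum ψ (b + x) xs) ≡⟨ cong (λ c → (b ∸ a) * ψ a + (c * ψ b + blockSum ψ (b + x) xs)) (m+n∸m≡n b x) ⟩
  (b ∸ a) * ψ a + (x * ψ b + blockSum ψ (b + x) xs)            ∎
  where
  open ≡-Reasoning
  rest : rangeSum (a + (b ∸ a)) (x + sum xs) ψ ≡ rangeSum b (((b + x) ∸ b) + sum xs) ψ
  rest = cong₂ (λ c d → rangeSum c d ψ) (m+[n∸m]≡n a≤b) (cong (_+ sum xs) (sym (m+n∸m≡n b x)))
  block₀ : rangeSum a (b ∸ a) ψ ≡ (b ∸ a) * ψ a
  block₀ = rangeSum-constant a (b ∸ a) ψ (λ k a≤k k+1<end →
    let k+1<b = subst (suc k <_) (m+[n∸m]≡n a≤b) k+1<end in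
    step k a≤k (≤-trans k+1<b (m≤m+n b _))
      (trans (blockIndex-below b (x ∷ xs) (<-trans (n<1+n k) k+1<b)) (sym (blockIndex-below b (x ∷ xs) k+1<b))))
  step′ : ∀ k → b ≤ k → suc k < b + x + sum xs → blockIndex (b + x) xs k ≡ blockIndex (b + x) xs (suc k) → ψ k ≡ ψ (suc k)
  step′ k b≤k k+1<end same = step k (≤-trans a≤b b≤k) (subst (suc k <_) (+-assoc b x (sum xs)) k+1<end)
    (cong₂ _+_ (cong bool→ℕ (trans (≤ᵇ-true b≤k) (sym (≤ᵇ-true (m≤n⇒m≤1+n b≤k))))) same)

∑-blockwise : ∀ {n} b L (ψ : ℕ → ℕ) → b + sum L ≡ n →
  (∀ k → suc k < n → blockIndex b L k ≡ blockIndex b L (suc k) → ψ k ≡ ψ (suc k)) →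
  ℕΣ.sum {n} (ψ ∘ toℕ) ≡ b * ψ 0 + blockSum ψ b L
∑-blockwise {n} b L ψ refl step = trans (∑≡rangeSum (b + sum L) ψ)
  (rangeSum-blocks 0 b L ψ z≤n (λ k _ → step k))

weightedSum : (ℕ → ℕ) → List ℕ → ℕ
weightedSum φ []       = 0
weightedSum φ (x ∷ xs) = x * φ 1 + weightedSum (φ ∘ suc) xs

weightedSum-cong : ∀ L {φ φ′ : ℕ → ℕ} → (∀ j → φ (suc j) ≡ φ′ (suc j)) → weightedSum φ L ≡ weightedSum φ′ L
weightedSum-cong []       eq = refl
weightedSum-cong (x ∷ xs) eq = cong₂ _+_ (cong (x *_) (eq 0)) (weightedSum-cong xs (eq ∘ suc))

blockSum-blockIndex : ∀ b L (φ : ℕ → ℕ) → All (1 ≤_) L → blockSum (φ ∘ blockIndex b L) b L ≡ weightedSum φ L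
blockSum-blockIndex b []       φ []          = refl
blockSum-blockIndex b (x ∷ xs) φ (1≤x ∷ pos) = cong₂ _+_ (cong (λ i → x * φ i) first)
  (trans (blockSum-cong (b + x) xs (λ t b+x≤t → cong φ (cong (_+ blockIndex (b + x) xs t)
                                     (cong bool→ℕ (≤ᵇ-true (≤-trans (m≤m+n b x) b+x≤t))))))
         (blockSum-blockIndex (b + x) xs (φ ∘ suc) pos))
  where
  first : bool→ℕ (b ≤ᵇ b) + blockIndex (b + x) xs b ≡ 1
  first rewrite ≤ᵇ-true (≤-refl {b}) = cong suc (blockIndex-below (b + x) xs (m<m+n b 1≤x))

∑-blockIndex : ∀ {n} b L (h : ℕ → ℕ) → b + sum L ≡ n → All (1 ≤_) L →
  ℕΣ.sum {n} (h ∘ blockIndex b L ∘ toℕ) ≡ b * h 0 + weightedSum h L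
∑-blockIndex {n} b L h total pos = begin
  ℕΣ.sum {n} (h ∘ blockIndex b L ∘ toℕ)                ≡⟨ ∑-blockwise {n} b L (h ∘ blockIndex b L) total (λ k _ → cong h) ⟩
  b * h (blockIndex b L 0) + blockSum (h ∘ blockIndex b L) b L ≡⟨ cong₂ _+_ (block₀ b) (blockSum-blockIndex b L h pos) ⟩
  b * h 0 + weightedSum h L                            ∎
  where
  open ≡-Reasoning
  block₀ : ∀ b → b * h (blockIndex b L 0) ≡ b * h 0
  block₀ zero    = refl
  block₀ (suc b) = cong (λ i → suc b * h i) (blockIndex-below (suc b) L (s≤s z≤n))

-- nth L j is the size of the block with index j + 1, and 0 past the end of L.
nth : List ℕ → ℕ → ℕ
nth []       j       = 0
nth (x ∷ xs) zero    = x
nth (x ∷ xs) (suc j) = nth xs j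

multiplicity : ℕ → List ℕ → ℕ
multiplicity c []       = 0
multiplicity c (x ∷ xs) = δ c x + multiplicity c xs

weightedSum-δ₀ : ∀ L → weightedSum (δ 0) L ≡ 0
weightedSum-δ₀ []       = refl
weightedSum-δ₀ (x ∷ xs) = trans (cong (_+ weightedSum (δ 0 ∘ suc) xs) (*-zeroʳ x))
  (trans (weightedSum-cong xs {φ′ = δ 0} (λ _ → refl)) (weightedSum-δ₀ xs))

weightedSum-δ : ∀ L j → weightedSum (δ (suc j)) L ≡ nth L j
weightedSum-δ []       j       = refl
weightedSum-δ (x ∷ xs) zero    = trans (cong₂ _+_ (*-identityʳ x) (weightedSum-δ₀ xs)) (+-identityʳ x)
weightedSum-δ (x ∷ xs) (suc j) = trans (cong (_+ weightedSum (δ (suc j)) xs) (*-zeroʳ x)) (weightedSum-δ xs j)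

weightedSum-multiplicity : ∀ c L (φ : ℕ → ℕ) → (∀ j → φ (suc j) ≡ δ c (nth L j)) →
  weightedSum φ L ≡ c * multiplicity c L
weightedSum-multiplicity c []       φ eq = sym (*-zeroʳ c)
weightedSum-multiplicity c (x ∷ xs) φ eq = begin
  x * φ 1 + weightedSum (φ ∘ suc) xs ≡⟨ cong₂ _+_ (cong (x *_) (eq 0)) (weightedSum-multiplicity c xs (φ ∘ suc) (eq ∘ suc)) ⟩
  x * δ c x + c * multiplicity c xs  ≡⟨ cong (_+ c * multiplicity c xs) (x*δcx c x) ⟩
  c * δ c x + c * multiplicity c xs  ≡⟨ sym (*-distribˡ-+ c _ _) ⟩
  c * (δ c x + multiplicity c xs)    ∎
  where
  open ≡-Reasoning
  x*δcx : ∀ c x → x * δ c x ≡ c * δ c x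
  x*δcx c x with c ≟ℕ x
  ... | yes refl = refl
  ... | no c≢x   = trans (cong (x *_) (δ-≢ c≢x)) (trans (*-zeroʳ x) (sym (trans (cong (c *_) (δ-≢ c≢x)) (*-zeroʳ c))))

parity-blockSum : ∀ ψ L → All (2 ∣_) L → ∀ b → parity (blockSum ψ b L) ≡ false
parity-blockSum ψ []       []              b = refl
parity-blockSum ψ (x ∷ xs) (2∣x ∷ evens) b = trans (parity-+ (x * ψ b) _)
  (cong₂ _xor_ (even⇒parity≡false (∣m⇒∣m*n (ψ b) 2∣x)) (parity-blockSum ψ xs evens (b + x)))

oddBlock : ∀ L → ¬ All (2 ∣_) L → Σ ℕ λ j → parity (nth L j) ≡ true
oddBlock []       notAllEven = ⊥-elim (notAllEven [])
oddBlock (x ∷ xs) notAllEven with parity x in eq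
... | true  = 0 , eq
... | false with oddBlock xs (λ evens → notAllEven (parity≡false⇒even x eq ∷ evens))
...   | j , odd = suc j , odd

multiplicity-0 : ∀ L → All (1 ≤_) L → multiplicity 0 L ≡ 0
multiplicity-0 []           []        = refl
multiplicity-0 (suc x ∷ xs) (_ ∷ pos) = multiplicity-0 xs pos

multiplicity-++ : ∀ c ys x zs → multiplicity c (ys ++ x ∷ zs) ≡ δ c x + multiplicity c (ys ++ zs)
multiplicity-++ c []       x zs = refl
multiplicity-++ c (y ∷ ys) x zs =
  trans (cong (δ c y +_) (multiplicity-++ c ys x zs)) (x∙yz≈y∙xz (δ c y) (δ c x) (multiplicity c (ys ++ zs)))

∈⇒split : ∀ x ys → 1 ≤ multiplicity x ys → Σ (List ℕ) λ ys₁ → Σ (List ℕ) λ ys₂ → ys ≡ ys₁ ++ x ∷ ys₂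
∈⇒split x (y ∷ ys) 1≤mult with x ≟ℕ y
... | yes refl = [] , ys , refl
... | no x≢y   with ∈⇒split x ys (subst (1 ≤_) (cong (_+ multiplicity x ys) (δ-≢ x≢y)) 1≤mult)
...   | ys₁ , ys₂ , refl = y ∷ ys₁ , ys₂ , refl

multiplicity⇒↭ : ∀ xs ys → (∀ c → multiplicity c xs ≡ multiplicity c ys) → xs ↭ ys
multiplicity⇒↭ []       []       _    = ↭-refl
multiplicity⇒↭ []       (y ∷ ys) same = ⊥-elim (0≢1+n (trans (same y) (cong (_+ multiplicity y ys) (δ-refl y))))
multiplicity⇒↭ (x ∷ xs) ys       same
  with ∈⇒split x ys (subst (1 ≤_) (trans (cong (_+ multiplicity x xs) (sym (δ-refl x))) (same x)) (s≤s z≤n))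
... | ys₁ , ys₂ , refl = ↭-trans (prep x (multiplicity⇒↭ xs (ys₁ ++ ys₂) same′)) (↭-sym (shift x ys₁ ys₂))
  where
  same′ : ∀ c → multiplicity c xs ≡ multiplicity c (ys₁ ++ ys₂)
  same′ c = +-cancelˡ-≡ (δ c x) _ _ (trans (same c) (multiplicity-++ c ys₁ x ys₂))

module AroundPair (b : ℕ) (P : List ℕ) (x y : ℕ) (R : List ℕ) where
  p : ℕ
  p = b + sum P

  index : ℕ → ℕ
  index = blockIndex b (P ++ x ∷ y ∷ R)

  index-split : ∀ u → index u ≡ blockIndex b P u + (bool→ℕ (p ≤ᵇ u) + (bool→ℕ (p + x ≤ᵇ u) + blockIndex (p + x + y) R u))
  index-split u = blockIndex-++ b P (x ∷ y ∷ R) u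

  index-before : ∀ {u} → u < p → index u ≡ blockIndex b P u
  index-before {u} u<p = trans (index-split u)
    (trans (cong (blockIndex b P u +_) (blockIndex-below p (x ∷ y ∷ R) u<p)) (+-identityʳ _))

  index-first : ∀ {u} → p ≤ u → u < p + x → index u ≡ length P + 1
  index-first {u} p≤u u<p+x = trans (index-split u) (cong₂ _+_ (blockIndex-above b P p≤u)
    (cong₂ _+_ (cong bool→ℕ (≤ᵇ-true p≤u)) (cong₂ _+_ (cong bool→ℕ (≤ᵇ-false u<p+x))
      (blockIndex-below (p + x + y) R (≤-trans u<p+x (m≤m+n _ y))))))

  index-second : ∀ {u} → p + x ≤ u → u < p + x + y → index u ≡ length P + 2
  index-second {u} p+x≤u u<end = trans (index-split u) (cong₂ _+_ (blockIndex-above b P p≤u)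
    (cong₂ _+_ (cong bool→ℕ (≤ᵇ-true p≤u)) (cong₂ _+_ (cong bool→ℕ (≤ᵇ-true p+x≤u))
      (blockIndex-below (p + x + y) R u<end))))
    where
    p≤u : p ≤ u
    p≤u = ≤-trans (m≤m+n p x) p+x≤u

  index-after : ∀ {u} → p + x + y ≤ u → index u ≡ length P + (2 + blockIndex (p + x + y) R u)
  index-after {u} end≤u = trans (index-split u) (cong₂ _+_ (blockIndex-above b P p≤u)
    (cong₂ _+_ (cong bool→ℕ (≤ᵇ-true p≤u))
      (cong (_+ blockIndex (p + x + y) R u) (cong bool→ℕ (≤ᵇ-true (≤-trans (m≤m+n (p + x) y) end≤u))))))
    where
    p≤u : p ≤ u
    p≤u = ≤-trans (≤-trans (m≤m+n p x) (m≤m+n (p + x) y)) end≤u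

-- rotate p a c moves [p, p+c) up by a and [p+c, p+c+a) down by c: it exchanges
-- a block of size c followed by one of size a into a block of size a followed by one of size c.
rotate : ℕ → ℕ → ℕ → ℕ → ℕ
rotate p a c t =
  if suc t ≤ᵇ p then t else if suc t ≤ᵇ p + c then t + a else if suc t ≤ᵇ p + c + a then t ∸ c else t

rotate-before : ∀ p a c {t} → t < p → rotate p a c t ≡ t
rotate-before p a c t<p rewrite ≤ᵇ-true t<p = refl

rotate-up : ∀ p a c {t} → p ≤ t → t < p + c → rotate p a c t ≡ t + a
rotate-up p a c p≤t t<p+c rewrite ≤ᵇ-false (s≤s p≤t) | ≤ᵇ-true t<p+c = refl

rotate-down : ∀ p a c {t} → p + c ≤ t → t < p + c + a → rotate p a c t ≡ t ∸ c
rotate-down p a c p+c≤t t<end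
  rewrite ≤ᵇ-false (s≤s (≤-trans (m≤m+n p c) p+c≤t)) | ≤ᵇ-false (s≤s p+c≤t) | ≤ᵇ-true t<end = refl

rotate-after : ∀ p a c {t} → p + c + a ≤ t → rotate p a c t ≡ t
rotate-after p a c end≤t
  rewrite ≤ᵇ-false (s≤s (≤-trans (≤-trans (m≤m+n p c) (m≤m+n (p + c) a)) end≤t))
        | ≤ᵇ-false (s≤s (≤-trans (m≤m+n (p + c) a) end≤t)) | ≤ᵇ-false (s≤s end≤t) = refl

down-lower : ∀ p {c t} → p + c ≤ t → p ≤ t ∸ c
down-lower p = m+n≤o⇒m≤o∸n p

down-upper : ∀ p a c {t} → p + c ≤ t → t < p + c + a → t ∸ c < p + a
down-upper p a c {t} p+c≤t t<end = subst (t ∸ c <_) (trans (cong (_∸ c) (xy∙z≈xz∙y p c a)) (m+n∸n≡m (p + a) c))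
  (∸-monoˡ-< t<end (≤-trans (m≤n+m c p) p+c≤t))

rotate-inverse : ∀ p a c t → rotate p c a (rotate p a c t) ≡ t
rotate-inverse p a c t with t <? p | t <? p + c | t <? p + c + a
... | yes t<p | _ | _ = trans (cong (rotate p c a) (rotate-before p a c t<p)) (rotate-before p c a t<p)
... | no t≮p | yes t<p+c | _ =
  trans (cong (rotate p c a) (rotate-up p a c (≮⇒≥ t≮p) t<p+c))
    (trans (rotate-down p c a (+-monoˡ-≤ a (≮⇒≥ t≮p)) (subst (t + a <_) (xy∙z≈xz∙y p c a) (+-monoˡ-< a t<p+c)))
           (m+n∸n≡m t a))
... | no _ | no t≮p+c | yes t<end =
  trans (cong (rotate p c a) (rotate-down p a c (≮⇒≥ t≮p+c) t<end))
    (trans (rotate-up p c a (down-lower p (≮⇒≥ t≮p+c)) (down-upper p a c (≮⇒≥ t≮p+c) t<end))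
           (m∸n+n≡m (≤-trans (m≤n+m c p) (≮⇒≥ t≮p+c))))
... | no _ | no _ | no t≮end =
  trans (cong (rotate p c a) (rotate-after p a c (≮⇒≥ t≮end)))
    (rotate-after p c a (subst (_≤ t) (xy∙z≈xz∙y p c a) (≮⇒≥ t≮end)))

rotate-< : ∀ p a c {n t} → t < n → p + c + a ≤ n → rotate p a c t < n
rotate-< p a c {n} {t} t<n end≤n with t <? p | t <? p + c | t <? p + c + a
... | yes t<p | _ | _ = subst (_< n) (sym (rotate-before p a c t<p)) t<n
... | no t≮p | yes t<p+c | _ = subst (_< n) (sym (rotate-up p a c (≮⇒≥ t≮p) t<p+c)) (≤-trans (+-monoˡ-< a t<p+c) end≤n)
... | no _ | no t≮p+c | yes t<end = subst (_< n) (sym (rotate-down p a c (≮⇒≥ t≮p+c) t<end)) (≤-<-trans (m∸n≤m t c) t<n)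
... | no _ | no _ | no t≮end = subst (_< n) (sym (rotate-after p a c (≮⇒≥ t≮end))) t<n

-- rotate p a c carries the blocks of K = P ++ c ∷ a ∷ R onto those of J = P ++ a ∷ c ∷ R.

module ExchangeBlocks (b : ℕ) (P : List ℕ) (a c : ℕ) (R : List ℕ) {n : ℕ}
                      (1≤a : 1 ≤ a) (1≤c : 1 ≤ c) (total : b + sum P + (c + (a + sum R)) ≡ n) where
  p : ℕ
  p = b + sum P

  module K = AroundPair b P c a R
  module J = AroundPair b P a c R

  r : ℕ → ℕ
  r = rotate p a c

  SameBlockAfter : ℕ → Set
  SameBlockAfter t = r (suc t) ≡ suc (r t) × J.index (r t) ≡ J.index (suc (r t))

  before : ∀ {t} → suc t < p → K.index t ≡ K.index (suc t) → SameBlockAfter t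
  before {t} t+1<p same =
    trans (rotate-before p a c t+1<p) (cong suc (sym (rotate-before p a c t<p))) ,
    (begin
      J.index (r t)         ≡⟨ cong J.index (rotate-before p a c t<p) ⟩
      J.index t             ≡⟨ trans (J.index-before t<p) (sym (K.index-before t<p)) ⟩
      K.index t             ≡⟨ same ⟩
      K.index (suc t)       ≡⟨ trans (K.index-before t+1<p) (sym (J.index-before t+1<p)) ⟩
      J.index (suc t)       ≡⟨ cong (J.index ∘ suc) (sym (rotate-before p a c t<p)) ⟩
      J.index (suc (r t))   ∎)
    where
    open ≡-Reasoning
    t<p : t < p
    t<p = <⇒≤ t+1<p

  moved-up : ∀ {t} → p < suc t → suc t < p + c → SameBlockAfter t
  moved-up {t} p<t+1 t+1<p+c =
    trans (rotate-up p a c (<⇒≤ p<t+1) t+1<p+c) (cong suc (sym (rotate-up p a c p≤t (<⇒≤ t+1<p+c)))) ,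
    subst (λ u → J.index u ≡ J.index (suc u)) (sym (rotate-up p a c p≤t (<⇒≤ t+1<p+c)))
      (trans (J.index-second (+-monoˡ-≤ a p≤t) (subst (t + a <_) (xy∙z≈xz∙y p c a) (+-monoˡ-< a (<⇒≤ t+1<p+c))))
        (sym (J.index-second (≤-trans (+-monoˡ-≤ a p≤t) (n≤1+n _)) (subst (suc (t + a) <_) (xy∙z≈xz∙y p c a) (+-monoˡ-< a t+1<p+c)))))
    where
    p≤t : p ≤ t
    p≤t = ≤-pred p<t+1

  moved-down : ∀ {t} → p + c < suc t → suc t < p + c + a → SameBlockAfter t
  moved-down {t} p+c<t+1 t+1<end =
    trans (rotate-down p a c (<⇒≤ p+c<t+1) t+1<end)
      (trans (+-∸-assoc 1 c≤t) (cong suc (sym (rotate-down p a c p+c≤t (<⇒≤ t+1<end))))) ,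
    subst (λ u → J.index u ≡ J.index (suc u)) (sym (rotate-down p a c p+c≤t (<⇒≤ t+1<end)))
      (trans (J.index-first (down-lower p p+c≤t) (down-upper p a c p+c≤t (<⇒≤ t+1<end)))
        (sym (J.index-first (≤-trans (down-lower p p+c≤t) (n≤1+n _))
          (subst (_< p + a) (+-∸-assoc 1 c≤t) (down-upper p a c (<⇒≤ p+c<t+1) t+1<end)))))
    where
    p+c≤t : p + c ≤ t
    p+c≤t = ≤-pred p+c<t+1
    c≤t : c ≤ t
    c≤t = ≤-trans (m≤n+m c p) p+c≤t

  after : ∀ {t} → p + c + a < suc t → K.index t ≡ K.index (suc t) → SameBlockAfter t
  after {t} end<t+1 same =
    trans (rotate-after p a c (<⇒≤ end<t+1)) (cong suc (sym (rotate-after p a c end≤t))) ,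
    trans (cong J.index (rotate-after p a c end≤t))
      (trans (J≡K end≤t) (trans same (trans (sym (J≡K (<⇒≤ end<t+1))) (cong (J.index ∘ suc) (sym (rotate-after p a c end≤t))))))
    where
    end≤t : p + c + a ≤ t
    end≤t = ≤-pred end<t+1
    J≡K : ∀ {u} → p + c + a ≤ u → J.index u ≡ K.index u
    J≡K {u} end≤u = trans (J.index-after (subst (_≤ u) (xy∙z≈xz∙y p c a) end≤u))
      (trans (cong (λ e → length P + (2 + blockIndex e R u)) (sym (xy∙z≈xz∙y p c a))) (sym (K.index-after end≤u)))

  cut-p : ∀ {t} → suc t ≡ p → K.index t ≢ K.index (suc t)
  cut-p {t} t+1≡p same = m+1+n≰m (length P) (subst (_≤ length P) (K.index-first p≤t+1 t+1<p+c) index≤)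
    where
    p≤t+1 : p ≤ suc t
    p≤t+1 = ≤-reflexive (sym t+1≡p)
    t+1<p+c : suc t < p + c
    t+1<p+c = subst (_< p + c) (sym t+1≡p) (m<m+n p 1≤c)
    index≤ : K.index (suc t) ≤ length P
    index≤ = subst (_≤ length P) (trans (sym (K.index-before (subst (t <_) t+1≡p (n<1+n t)))) same)
               (blockIndex-≤length b P t)

  cut-p+c : ∀ {t} → suc t ≡ p + c → K.index t ≢ K.index (suc t)
  cut-p+c {t} t+1≡p+c same = 1+n≢n (+-cancelˡ-≡ (length P) _ _ (begin
    length P + 2             ≡⟨ sym (K.index-second (≤-reflexive (sym t+1≡p+c)) (subst (_< p + c + a) (sym t+1≡p+c) (m<m+n (p + c) 1≤a))) ⟩
    K.index (suc t)          ≡⟨ sym same ⟩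
    K.index t                ≡⟨ K.index-first (≤-pred (subst (p <_) (sym t+1≡p+c) (m<m+n p 1≤c))) (subst (t <_) t+1≡p+c (n<1+n t)) ⟩
    length P + 1             ∎))
    where open ≡-Reasoning

  cut-end : ∀ {t} → suc t < n → suc t ≡ p + c + a → K.index t ≢ K.index (suc t)
  cut-end {t} t+1<n t+1≡end same = <-irrefl (trans t+1≡end end≡n) t+1<n
    where
    index≡ : length P + (2 + blockIndex (p + c + a) R (suc t)) ≡ length P + (2 + 0)
    index≡ = begin
      length P + (2 + blockIndex (p + c + a) R (suc t)) ≡⟨ sym (K.index-after (≤-reflexive (sym t+1≡end))) ⟩
      K.index (suc t)                                   ≡⟨ sym same ⟩
      K.index t                                         ≡⟨ K.index-second (≤-pred (subst (p + c <_) (sym t+1≡end) (m<m+n (p + c) 1≤a))) (subst (t <_) t+1≡end (n<1+n t)) ⟩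
      length P + 2                                      ∎
      where open ≡-Reasoning
    R≡[] : R ≡ []
    R≡[] = blockIndex-start≡0 (p + c + a) R (subst (λ u → blockIndex (p + c + a) R u ≡ 0) t+1≡end
             (+-cancelˡ-≡ 2 _ 0 (+-cancelˡ-≡ (length P) _ _ index≡)))
    end≡n : p + c + a ≡ n
    end≡n = trans (+-assoc p c a)
      (trans (cong (λ e → p + (c + e)) (sym (trans (cong (λ L → a + sum L) R≡[]) (+-identityʳ a)))) total)

  rotate-sameBlock : ∀ t → suc t < n → K.index t ≡ K.index (suc t) → SameBlockAfter t
  rotate-sameBlock t t+1<n same with <-cmp (suc t) p
  ... | tri< t+1<p _ _ = before t+1<p same
  ... | tri≈ _ t+1≡p _ = ⊥-elim (cut-p t+1≡p same)
  ... | tri> _ _ p<t+1 with <-cmp (suc t) (p + c)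
  ...   | tri< t+1<p+c _ _ = moved-up p<t+1 t+1<p+c
  ...   | tri≈ _ t+1≡p+c _ = ⊥-elim (cut-p+c t+1≡p+c same)
  ...   | tri> _ _ p+c<t+1 with <-cmp (suc t) (p + c + a)
  ...     | tri< t+1<end _ _ = moved-down p+c<t+1 t+1<end
  ...     | tri≈ _ t+1≡end _ = ⊥-elim (cut-end t+1<n t+1≡end same)
  ...     | tri> _ _ end<t+1 = after end<t+1 same

-- Conjugacy of standard subsets

module _ {m : ℕ} where

  n : ℕ
  n = suc (suc m)

  2≤n : 2 ≤ n
  2≤n = s≤s (s≤s z≤n)

  gen : Gen n → X n → X n
  gen = genFun 2≤n

  -- Complements of the subsets attached to compositions have this form (up to ρ below).
  Standard : ℕ → Bool → List ℕ → SubsetS n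
  Standard b D L s1'   = D
  Standard b D L (s k) = not (elemℕ (suc (toℕ k)) (partialSums b L))

  inStandard⇒sameBlock : ∀ b L k → Standard b false L (s k) ≡ true →
                         blockIndex b L (toℕ k) ≡ blockIndex b L (suc (toℕ k))
  inStandard⇒sameBlock b L k k∈ =
    Equivalence.from (sameBlock⇔notCut b L (toℕ k)) (trans (sym (not-involutive _)) (cong not k∈))

  sameBlock⇒inStandard : ∀ b D L k → blockIndex b L (toℕ k) ≡ blockIndex b L (suc (toℕ k)) →
                         Standard b D L (s k) ≡ true
  sameBlock⇒inStandard b D L k same = cong not (Equivalence.to (sameBlock⇔notCut b L (toℕ k)) same)

  ρ : Gen n → Gen n
  ρ s1'            = s Fin.zero
  ρ (s Fin.zero)   = s1'
  ρ (s (Fin.suc k)) = s (Fin.suc k)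

  ρ-involutive : ∀ g → ρ (ρ g) ≡ g
  ρ-involutive s1'              = refl
  ρ-involutive (s Fin.zero)     = refl
  ρ-involutive (s (Fin.suc k))  = refl

  isFirst : Fin n → Bool
  isFirst Fin.zero    = true
  isFirst (Fin.suc _) = false

  τ : SignedPerm n
  τ = flipSigns isFirst

  signParity-τ : signParity τ ≡ true
  signParity-τ = cong (true xor_) (⊕Σ.sum-replicate-zero (suc m))

  τ-conjugates : ∀ g → Conjugates 2≤n τ g (ρ g)
  τ-conjugates s1'             (Fin.zero , false)            = refl
  τ-conjugates s1'             (Fin.zero , true)             = refl
  τ-conjugates s1'             (Fin.suc Fin.zero , false)    = refl
  τ-conjugates s1'             (Fin.suc Fin.zero , true)     = refl
  τ-conjugates s1'             (Fin.suc (Fin.suc _) , false) = refl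
  τ-conjugates s1'             (Fin.suc (Fin.suc _) , true)  = refl
  τ-conjugates (s Fin.zero)    (Fin.zero , false)            = refl
  τ-conjugates (s Fin.zero)    (Fin.zero , true)             = refl
  τ-conjugates (s Fin.zero)    (Fin.suc Fin.zero , false)    = refl
  τ-conjugates (s Fin.zero)    (Fin.suc Fin.zero , true)     = refl
  τ-conjugates (s Fin.zero)    (Fin.suc (Fin.suc _) , false) = refl
  τ-conjugates (s Fin.zero)    (Fin.suc (Fin.suc _) , true)  = refl
  τ-conjugates (s (Fin.suc k)) (Fin.zero , false)            = refl
  τ-conjugates (s (Fin.suc k)) (Fin.zero , true)             = refl
  τ-conjugates (s (Fin.suc k)) (Fin.suc j , b) =
    cong (_ ,_) (trans (cong ((b xor false) xor_) (swapped-not-first j)) (trans (xor-identityʳ _) (xor-identityʳ b)))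
    where
    swapped-not-first : ∀ j → isFirst (swapFin (Fin.suc (inject₁ k)) (Fin.suc (Fin.suc k)) (Fin.suc j)) ≡ false
    swapped-not-first j with does (j ≟ inject₁ k) | does (j ≟ Fin.suc k)
    ... | true  | _     = refl
    ... | false | true  = refl
    ... | false | false = refl

  signParity-τ⁻¹ : signParity (inverse τ) ≡ true
  signParity-τ⁻¹ = trans (signParity-inverse τ) signParity-τ

  τ-intertwines : ∀ U → Intertwines 2≤n τ (U ∘ ρ) U
  τ-intertwines U =
    (λ g Ug → ρ g , Ug , τ-conjugates g) ,
    (λ g Ug → ρ g , subst (λ h → U h ≡ true) (sym (ρ-involutive g)) Ug ,
              λ x → trans (τ-conjugates (ρ g) x) (cong (λ h → gen h x) (ρ-involutive g)))

  τ⁻¹-intertwines : ∀ U → Intertwines 2≤n (inverse τ) U (U ∘ ρ)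
  τ⁻¹-intertwines U = intertwines-inverse 2≤n τ (τ-intertwines U)

  FixesFirstTwo : (Fin n → Fin n) → Set
  FixesFirstTwo f = f Fin.zero ≡ Fin.zero × f (Fin.suc Fin.zero) ≡ Fin.suc Fin.zero

  CarriesAdjacent : (Fin n → Fin n) → ℕ → List ℕ → ℕ → List ℕ → Set
  CarriesAdjacent f b L b′ L′ = ∀ (k : Fin (suc m)) → blockIndex b L (toℕ k) ≡ blockIndex b L (suc (toℕ k)) →
    toℕ (f (Fin.suc k)) ≡ suc (toℕ (f (inject₁ k))) ×
    blockIndex b′ L′ (toℕ (f (inject₁ k))) ≡ blockIndex b′ L′ (suc (toℕ (f (inject₁ k))))

  positions-conjugate : ∀ (π : Permutation′ n) {bJ LJ bK LK D} →
    CarriesAdjacent (π ⟨$⟩ˡ_) bJ LJ bK LK → (D ≡ true → FixesFirstTwo (π ⟨$⟩ˡ_)) →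
    ∀ g → Standard bJ D LJ g ≡ true → Σ (Gen n) λ g′ → Standard bK D LK g′ ≡ true × Conjugates 2≤n (permutePositions π) g g′
  positions-conjugate π carry fixes s1' D≡true = s1' , D≡true , s1'-conj
    where
    ℓ0 : π ⟨$⟩ˡ Fin.zero ≡ Fin.zero
    ℓ0 = proj₁ (fixes D≡true)
    ℓ1 : π ⟨$⟩ˡ Fin.suc Fin.zero ≡ Fin.suc Fin.zero
    ℓ1 = proj₂ (fixes D≡true)
    r0 : π ⟨$⟩ʳ Fin.zero ≡ Fin.zero
    r0 = trans (cong (π ⟨$⟩ʳ_) (sym ℓ0)) (inverseʳ π)
    r1 : π ⟨$⟩ʳ Fin.suc Fin.zero ≡ Fin.suc Fin.zero
    r1 = trans (cong (π ⟨$⟩ʳ_) (sym ℓ1)) (inverseʳ π)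
    back : ∀ {i j} → π ⟨$⟩ʳ i ≡ j → π ⟨$⟩ˡ j ≡ i
    back eq = trans (cong (π ⟨$⟩ˡ_) (sym eq)) (inverseˡ π)
    s1'-conj : Conjugates 2≤n (permutePositions π) s1' s1'
    s1'-conj (Fin.zero , b)         = trans (cong (λ i → from (permutePositions π) (gen s1' (i , b))) r0) (cong (_, not b) ℓ1)
    s1'-conj (Fin.suc Fin.zero , b) = trans (cong (λ i → from (permutePositions π) (gen s1' (i , b))) r1) (cong (_, not b) ℓ0)
    s1'-conj (Fin.suc (Fin.suc j) , b) with π ⟨$⟩ʳ Fin.suc (Fin.suc j) in eq
    ... | Fin.zero            = ⊥-elim (Finₚ.0≢1+n (trans (sym ℓ0) (back eq)))
    ... | Fin.suc Fin.zero    = ⊥-elim (Finₚ.0≢1+n (Finₚ.suc-injective (trans (sym ℓ1) (back eq))))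
    ... | Fin.suc (Fin.suc i) = cong (_, b) (back eq)
  positions-conjugate π {bJ} {LJ} {bK} {LK} {D} carry fixes (s k) k∈J = s k′ , k′∈K , swap-conj
    where
    shifted : toℕ (π ⟨$⟩ˡ Fin.suc k) ≡ suc (toℕ (π ⟨$⟩ˡ inject₁ k))
    shifted = proj₁ (carry k (inStandard⇒sameBlock bJ LJ k k∈J))
    bound : toℕ (π ⟨$⟩ˡ inject₁ k) < suc m
    bound = ≤-pred (subst (_< n) shifted (Finₚ.toℕ<n (π ⟨$⟩ˡ Fin.suc k)))
    k′ : Fin (suc m)
    k′ = fromℕ< bound
    toℕ-k′ : toℕ k′ ≡ toℕ (π ⟨$⟩ˡ inject₁ k)
    toℕ-k′ = Finₚ.toℕ-fromℕ< bound
    k′∈K : Standard bK D LK (s k′) ≡ true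
    k′∈K = sameBlock⇒inStandard bK D LK k′ (subst (λ t → blockIndex bK LK t ≡ blockIndex bK LK (suc t)) (sym toℕ-k′)
             (proj₂ (carry k (inStandard⇒sameBlock bJ LJ k k∈J))))
    swap-conj : Conjugates 2≤n (permutePositions π) (s k) (s k′)
    swap-conj (j , b) = cong (_, b) (trans (swapFin-conjugate π (inject₁ k) (Fin.suc k) j)
      (cong₂ (λ u v → swapFin u v j)
        (Finₚ.toℕ-injective (sym (trans (Finₚ.toℕ-inject₁ k′) toℕ-k′)))
        (Finₚ.toℕ-injective (trans shifted (cong suc (sym toℕ-k′))))))

  permutePositions-intertwines : ∀ (π : Permutation′ n) {bJ LJ bK LK D} →
    CarriesAdjacent (π ⟨$⟩ˡ_) bJ LJ bK LK → CarriesAdjacent (π ⟨$⟩ʳ_) bK LK bJ LJ →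
    (D ≡ true → FixesFirstTwo (π ⟨$⟩ˡ_)) →
    Intertwines 2≤n (permutePositions π) (Standard bJ D LJ) (Standard bK D LK)
  permutePositions-intertwines π {D = D} carry carry⁻¹ fixes =
    positions-conjugate π carry fixes ,
    λ g′ g′∈K → let (g , g∈J , c) = positions-conjugate (flip π) carry⁻¹ fixes⁻¹ g′ g′∈K in
                g , g∈J , conjugates-inverse 2≤n (permutePositions (flip π)) {g′} {g} c
    where
    fixes⁻¹ : D ≡ true → FixesFirstTwo (π ⟨$⟩ʳ_)
    fixes⁻¹ D≡true = let (ℓ0 , ℓ1) = fixes D≡true in
      trans (cong (π ⟨$⟩ʳ_) (sym ℓ0)) (inverseʳ π) , trans (cong (π ⟨$⟩ʳ_) (sym ℓ1)) (inverseʳ π)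

  rotateFin : ∀ p a c → p + c + a ≤ n → Fin n → Fin n
  rotateFin p a c fits i = fromℕ< (rotate-< p a c (Finₚ.toℕ<n i) fits)

  toℕ-rotateFin : ∀ p a c fits i → toℕ (rotateFin p a c fits i) ≡ rotate p a c (toℕ i)
  toℕ-rotateFin p a c fits i = Finₚ.toℕ-fromℕ< _

  rotateFin-inverse : ∀ p a c fits fits′ i → rotateFin p c a fits′ (rotateFin p a c fits i) ≡ i
  rotateFin-inverse p a c fits fits′ i = Finₚ.toℕ-injective (trans (toℕ-rotateFin p c a fits′ _)
    (trans (cong (rotate p c a) (toℕ-rotateFin p a c fits i)) (rotate-inverse p a c (toℕ i))))

  rotateFin-carries : ∀ b P a c R → 1 ≤ a → 1 ≤ c → (total : b + sum P + (c + (a + sum R)) ≡ n) →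
    (fits : b + sum P + c + a ≤ n) → CarriesAdjacent (rotateFin (b + sum P) a c fits) b (P ++ c ∷ a ∷ R) b (P ++ a ∷ c ∷ R)
  rotateFin-carries b P a c R 1≤a 1≤c total fits k same
    with ExchangeBlocks.rotate-sameBlock b P a c R 1≤a 1≤c total (toℕ k) (Finₚ.toℕ<n (Fin.suc k)) same
  ... | shifted , same′ =
    trans (toℕ-rotateFin p a c fits (Fin.suc k)) (trans shifted (cong suc (sym toℕ-r))) ,
    subst (λ t → blockIndex b (P ++ a ∷ c ∷ R) t ≡ blockIndex b (P ++ a ∷ c ∷ R) (suc t)) (sym toℕ-r) same′
    where
    p : ℕ
    p = b + sum P
    toℕ-r : toℕ (rotateFin p a c fits (inject₁ k)) ≡ rotate p a c (toℕ k)
    toℕ-r = trans (toℕ-rotateFin p a c fits (inject₁ k)) (cong (rotate p a c) (Finₚ.toℕ-inject₁ k))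

  exchangeBlocks : ∀ b D P a c R → 1 ≤ a → 1 ≤ c → b + sum P + (c + (a + sum R)) ≡ n → (D ≡ true → 2 ≤ b) →
    SignedConjugate 2≤n (Standard b D (P ++ a ∷ c ∷ R)) (Standard b D (P ++ c ∷ a ∷ R))
  exchangeBlocks b D P a c R 1≤a 1≤c total 2≤b =
    permutePositions π , signParity-permutePositions π ,
    permutePositions-intertwines π (rotateFin-carries b P c a R 1≤c 1≤a total′ fits′)
                                   (rotateFin-carries b P a c R 1≤a 1≤c total fits) fixes
    where
    p : ℕ
    p = b + sum P
    total′ : p + (a + (c + sum R)) ≡ n
    total′ = trans (cong (p +_) (x∙yz≈y∙xz a c (sum R))) total
    fits : p + c + a ≤ n
    fits = ≤-trans (≤-reflexive (+-assoc p c a)) (≤-trans (+-monoʳ-≤ p (+-monoʳ-≤ c (m≤m+n a (sum R)))) (≤-reflexive total))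
    fits′ : p + a + c ≤ n
    fits′ = subst (_≤ n) (xy∙z≈xz∙y p c a) fits
    π : Permutation′ n
    π = permutation (rotateFin p a c fits) (rotateFin p c a fits′)
          (rotateFin-inverse p c a fits′ fits) (rotateFin-inverse p a c fits fits′)
    fixes : D ≡ true → FixesFirstTwo (rotateFin p c a fits′)
    fixes D≡true =
      Finₚ.toℕ-injective (trans (toℕ-rotateFin p c a fits′ Fin.zero) (rotate-before p c a (≤-trans (s≤s z≤n) 2≤p))) ,
      Finₚ.toℕ-injective (trans (toℕ-rotateFin p c a fits′ (Fin.suc Fin.zero)) (rotate-before p c a 2≤p))
      where
      2≤p : 2 ≤ p
      2≤p = ≤-trans (2≤b D≡true) (m≤m+n b (sum P))

  permuteBlocks : ∀ b D P {xs ys} → xs ↭ ys → b + sum (P ++ xs) ≡ n → All (1 ≤_) (P ++ xs) → (D ≡ true → 2 ≤ b) →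
    SignedConjugate 2≤n (Standard b D (P ++ xs)) (Standard b D (P ++ ys))
  permuteBlocks b D P ↭-refl total pos 2≤b = signedConjugate-refl 2≤n _
  permuteBlocks b D P {x ∷ xs} {x ∷ ys} (prep x xs↭ys) total pos 2≤b =
    subst₂ (λ L L′ → SignedConjugate 2≤n (Standard b D L) (Standard b D L′)) (++-assoc P (x ∷ []) xs) (++-assoc P (x ∷ []) ys)
      (permuteBlocks b D (P ++ x ∷ []) xs↭ys
        (subst (λ L → b + sum L ≡ n) (sym (++-assoc P (x ∷ []) xs)) total)
        (subst (All (1 ≤_)) (sym (++-assoc P (x ∷ []) xs)) pos) 2≤b)
  permuteBlocks b D P {x ∷ y ∷ xs} {y ∷ x ∷ ys} (swap x y xs↭ys) total pos 2≤b =
    signedConjugate-trans 2≤n (exchangeBlocks b D P x y xs 1≤x 1≤y total′ 2≤b)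
      (subst₂ (λ L L′ → SignedConjugate 2≤n (Standard b D L) (Standard b D L′)) (++-assoc P (y ∷ x ∷ []) xs) (++-assoc P (y ∷ x ∷ []) ys)
        (permuteBlocks b D (P ++ y ∷ x ∷ []) xs↭ys
          (subst (λ L → b + sum L ≡ n) (sym (++-assoc P (y ∷ x ∷ []) xs))
            (trans (cong (λ L → b + L) (trans (sum-++ P _) (trans (cong (sum P +_) yx≡xy) (sym (sum-++ P _))))) total))
          (subst (All (1 ≤_)) (sym (++-assoc P (y ∷ x ∷ []) xs)) (All-resp-↭ (++⁺ˡ P (swap x y ↭-refl)) pos)) 2≤b))
    where
    yx≡xy : y + (x + sum xs) ≡ x + (y + sum xs)
    yx≡xy = x∙yz≈y∙xz y x (sum xs)
    total′ : b + sum P + (y + (x + sum xs)) ≡ n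
    total′ = trans (+-assoc b (sum P) _) (trans (cong (λ L → b + (sum P + L)) yx≡xy)
               (trans (cong (b +_) (sym (sum-++ P (x ∷ y ∷ xs)))) total))
    1≤x : 1 ≤ x
    1≤x with ++⁻ʳ P pos
    ... | 1≤x ∷ _ = 1≤x
    1≤y : 1 ≤ y
    1≤y with ++⁻ʳ P pos
    ... | _ ∷ 1≤y ∷ _ = 1≤y
  permuteBlocks b D P {xs} {zs} (↭-trans {ys = ys} xs↭ys ys↭zs) total pos 2≤b =
    signedConjugate-trans 2≤n (permuteBlocks b D P xs↭ys total pos 2≤b)
      (permuteBlocks b D P ys↭zs
        (trans (cong (λ L → b + L) (sum-++ P ys)) (trans (cong (λ L → b + (sum P + L)) (sym (sum-↭ xs↭ys)))
          (trans (cong (b +_) (sym (sum-++ P xs))) total)))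
        (All-resp-↭ (++⁺ˡ P xs↭ys) pos) 2≤b)

  flipSigns-intertwines : ∀ (ε : Fin n → Bool) b L →
    (∀ (k : Fin (suc m)) → blockIndex b L (toℕ k) ≡ blockIndex b L (suc (toℕ k)) → ε (inject₁ k) ≡ ε (Fin.suc k)) →
    Intertwines 2≤n (flipSigns ε) (Standard b false L) (Standard b false L)
  flipSigns-intertwines ε b L constant = intertwines-commuting 2≤n (flipSigns ε) commutes
    where
    commutes : ∀ g → Standard b false L g ≡ true → Conjugates 2≤n (flipSigns ε) g g
    commutes (s k) k∈ (j , c) = cong (swapFin (inject₁ k) (Fin.suc k) j ,_)
      (trans (cong ((c xor ε j) xor_) (swapFin-invariant ε (constant k (inStandard⇒sameBlock b L k k∈)) j))
             (xor-cancelʳ c (ε j)))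

  -- Flipping the signs on a block of odd size is odd and commutes with the standard subset,
  -- so composed with τ⁻¹ it conjugates U to U ∘ ρ inside D_n.
  oddBlock-twist : ∀ L j → parity (nth L j) ≡ true → sum L ≡ n → All (1 ≤_) L →
    SignedConjugate 2≤n (Standard 0 false L) (Standard 0 false L ∘ ρ)
  oddBlock-twist L j odd total pos =
    flipSigns ε ∘ₛ inverse τ ,
    trans (signParity-∘ (flipSigns ε) (inverse τ)) (cong₂ _xor_ ε-odd signParity-τ⁻¹) ,
    intertwines-∘ 2≤n (flipSigns ε) (inverse τ) (flipSigns-intertwines ε 0 L constant)
                  (τ⁻¹-intertwines (Standard 0 false L))
    where
    ε : Fin n → Bool
    ε i = suc j ≡ᵇ blockIndex 0 L (toℕ i)
    constant : ∀ (k : Fin (suc m)) → blockIndex 0 L (toℕ k) ≡ blockIndex 0 L (suc (toℕ k)) → ε (inject₁ k) ≡ ε (Fin.suc k)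
    constant k same = cong (suc j ≡ᵇ_) (trans (cong (blockIndex 0 L) (Finₚ.toℕ-inject₁ k)) same)
    ε-odd : ⊕Σ.sum ε ≡ true
    ε-odd = begin
      ⊕Σ.sum ε                                  ≡⟨ parity-∑ ε ⟨
      parity (ℕΣ.sum (bool→ℕ ∘ ε))              ≡⟨ cong parity (∑-blockIndex 0 L (δ (suc j)) total pos) ⟩
      parity (weightedSum (δ (suc j)) L)        ≡⟨ cong parity (weightedSum-δ L j) ⟩
      parity (nth L j)                          ≡⟨ odd ⟩
      true                                      ∎
      where open ≡-Reasoning

  ρ-signedConjugate : ∀ {U U′} → SignedConjugate 2≤n U U′ → SignedConjugate 2≤n (U ∘ ρ) (U′ ∘ ρ)
  ρ-signedConjugate {U} {U′} (σ , even , i) =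
    (τ ∘ₛ σ) ∘ₛ inverse τ ,
    trans (signParity-∘ (τ ∘ₛ σ) (inverse τ))
      (cong₂ _xor_ (trans (signParity-∘ τ σ) (cong₂ _xor_ signParity-τ even)) signParity-τ⁻¹) ,
    intertwines-∘ 2≤n (τ ∘ₛ σ) (inverse τ) (intertwines-∘ 2≤n τ σ (τ-intertwines U) i)
                  (τ⁻¹-intertwines U′)

  -- Invariants of the block structure

  record Shape (b : ℕ) (D : Bool) (L : List ℕ) : Set where
    field
      total    : b + sum L ≡ n
      positive : All (1 ≤_) L
      first    : (D ≡ true × 2 ≤ b) ⊎ (D ≡ false × b ≡ 0)

    2≤b : D ≡ true → 2 ≤ b
    2≤b D≡true with first
    ... | inj₁ (_ , 2≤b)     = 2≤b
    ... | inj₂ (D≡false , _) with trans (sym D≡true) D≡false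
    ...   | ()

    b≡0 : D ≡ false → b ≡ 0
    b≡0 D≡false with first
    ... | inj₂ (_ , b≡0)    = b≡0
    ... | inj₁ (D≡true , _) with trans (sym D≡true) D≡false
    ...   | ()

  label : ℕ → List ℕ → Fin n → ℕ
  label b L i = blockIndex b L (toℕ i)

  generator-preservesBlock : ∀ {b D L} → Shape b D L → ∀ g → Standard b D L g ≡ true →
    ∀ y → label b L (proj₁ (gen g y)) ≡ label b L (proj₁ y)
  generator-preservesBlock {b} {L = L} shape s1' D≡true (Fin.zero , _) =
    trans (blockIndex-below b L (Shape.2≤b shape D≡true)) (sym (blockIndex-below b L (≤-trans (s≤s z≤n) (Shape.2≤b shape D≡true))))
  generator-preservesBlock {b} {L = L} shape s1' D≡true (Fin.suc Fin.zero , _) =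
    trans (blockIndex-below b L (≤-trans (s≤s z≤n) (Shape.2≤b shape D≡true))) (sym (blockIndex-below b L (Shape.2≤b shape D≡true)))
  generator-preservesBlock shape s1' D≡true (Fin.suc (Fin.suc j) , _) = refl
  generator-preservesBlock {b} {L = L} shape (s k) k∈ (j , _) = swapFin-invariant (label b L)
    (trans (cong (blockIndex b L) (Finₚ.toℕ-inject₁ k)) (inStandard⇒sameBlock b L k k∈)) j

  CommutesInto : SignedPerm n → SubsetS n → SubsetS n → Set
  CommutesInto σ K J = ∀ g′ → K g′ ≡ true → Σ (Gen n) λ g → J g ≡ true × (∀ x → to σ (gen g′ x) ≡ gen g (to σ x))

  intertwines⇒commutesInto : ∀ σ {J K} → Intertwines 2≤n σ J K → CommutesInto σ K J
  intertwines⇒commutesInto σ (_ , σ←) g′ g′∈ =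
    let (g , g∈ , c) = σ← g′ g′∈ in g , g∈ , conjugates⇒commutes 2≤n σ {g} {g′} c

  toℕ-mod : ∀ {t} → t < n → toℕ (t mod n) ≡ t
  toℕ-mod t<n = trans (Finₚ.toℕ-fromℕ< _) (m<n⇒m%n≡m t<n)

  mod-toℕ : ∀ i → toℕ i mod n ≡ i
  mod-toℕ i = Finₚ.toℕ-injective (toℕ-mod (Finₚ.toℕ<n i))

  liftAdjacent : ∀ {A : Set} b L (f : Fin n → A) →
    (∀ (k : Fin (suc m)) → blockIndex b L (toℕ k) ≡ blockIndex b L (suc (toℕ k)) → f (inject₁ k) ≡ f (Fin.suc k)) →
    ∀ k → suc k < n → blockIndex b L k ≡ blockIndex b L (suc k) → f (k mod n) ≡ f (suc k mod n)
  liftAdjacent b L f adjacent k k+1<n same with fromℕ< (≤-pred k+1<n) | Finₚ.toℕ-fromℕ< (≤-pred k+1<n)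
  ... | k′ | refl = trans (cong f (sym k≡)) (trans (adjacent k′ same) (cong f k+1≡))
    where
    k≡ : inject₁ k′ ≡ toℕ k′ mod n
    k≡ = Finₚ.toℕ-injective (trans (Finₚ.toℕ-inject₁ k′) (sym (toℕ-mod (<-trans (n<1+n _) k+1<n))))
    k+1≡ : Fin.suc k′ ≡ suc (toℕ k′) mod n
    k+1≡ = Finₚ.toℕ-injective (sym (toℕ-mod k+1<n))

  position-sameBlock : ∀ σ {bK DK LK bJ DJ LJ} → Shape bJ DJ LJ → CommutesInto σ (Standard bK DK LK) (Standard bJ DJ LJ) →
    ∀ t u → label bK LK t ≡ label bK LK u → label bJ LJ (position σ t) ≡ label bJ LJ (position σ u)
  position-sameBlock σ {bK} {DK} {LK} {bJ} {DJ} {LJ} shapeJ commutes t u same = begin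
    f t                     ≡⟨ cong f (mod-toℕ t) ⟨
    f (toℕ t mod n)         ≡⟨ sameBlock-constant bK LK (f ∘ (_mod n)) (liftAdjacent bK LK f adjacent) (Finₚ.toℕ<n t) (Finₚ.toℕ<n u) same ⟩
    f (toℕ u mod n)         ≡⟨ cong f (mod-toℕ u) ⟩
    f u                     ∎
    where
    open ≡-Reasoning
    f : Fin n → ℕ
    f = label bJ LJ ∘ position σ
    adjacent : ∀ k → blockIndex bK LK (toℕ k) ≡ blockIndex bK LK (suc (toℕ k)) → f (inject₁ k) ≡ f (Fin.suc k)
    adjacent k same′ with commutes (s k) (sameBlock⇒inStandard bK DK LK k same′)
    ... | g , g∈ , c = begin
      label bJ LJ (position σ (inject₁ k))                       ≡⟨ generator-preservesBlock shapeJ g g∈ _ ⟨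
      label bJ LJ (proj₁ (gen g (to σ (inject₁ k , false))))     ≡⟨ cong (label bJ LJ ∘ proj₁) (c (inject₁ k , false)) ⟨
      label bJ LJ (proj₁ (to σ (gen (s k) (inject₁ k , false)))) ≡⟨ cong f (swapFin-left {a = inject₁ k} {Fin.suc k} refl) ⟩
      label bJ LJ (position σ (Fin.suc k))                       ∎

  label≡0⇒D : ∀ {b D L} → Shape b D L → ∀ t → label b L t ≡ 0 → D ≡ true
  label≡0⇒D {D = true} _ _ _ = refl
  label≡0⇒D {b} {false} {[]} shape _ _ with Shape.b≡0 shape refl | Shape.total shape
  ... | refl | ()
  label≡0⇒D {b} {false} {x ∷ xs} shape _ label≡0 with Shape.b≡0 shape refl
  ... | refl = ⊥-elim (1+n≢0 label≡0)

  -- Only s_{1'} changes signs, so the first block, which alone contains s_{1'}, is preserved.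
  position₀-firstBlock : ∀ σ {bK DK LK bJ DJ LJ} → Shape bK DK LK → Shape bJ DJ LJ →
    CommutesInto σ (Standard bK DK LK) (Standard bJ DJ LJ) → DK ≡ true →
    DJ ≡ true × label bJ LJ (position σ Fin.zero) ≡ 0
  position₀-firstBlock σ {bK} {DK} {LK} {bJ} {DJ} {LJ} shapeK shapeJ commutes DK≡true
    with commutes s1' DK≡true
       | commutes (s Fin.zero) (sameBlock⇒inStandard bK DK LK Fin.zero
           (trans (blockIndex-below bK LK (≤-trans (s≤s z≤n) 2≤bK)) (sym (blockIndex-below bK LK 2≤bK))))
    where
    2≤bK : 2 ≤ bK
    2≤bK = Shape.2≤b shapeK DK≡true
  ... | g , g∈ , c | g₁ , g₁∈ , c₁ = inFirst (to σ (Fin.zero , false)) g g₁ g∈ g₁∈ flips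
    where
    flips : neg (gen g₁ (to σ (Fin.zero , false))) ≡ gen g (to σ (Fin.zero , false))
    flips = trans (cong neg (sym (c₁ (Fin.zero , false)))) (trans (sym (to-neg σ (Fin.suc Fin.zero , false))) (c (Fin.zero , false)))
    not≢ : ∀ c → not c ≢ c
    not≢ c e = not-¬ refl (sym e)
    needs-s1' : ∀ y g g₁ → Standard bJ DJ LJ g ≡ true → Standard bJ DJ LJ g₁ ≡ true → neg (gen g₁ y) ≡ gen g y → DJ ≡ true
    needs-s1' y s1'    _      g∈ _   _       = g∈
    needs-s1' y (s k) s1'     _  g₁∈ _       = g₁∈
    needs-s1' y (s k) (s k₁)  _  _   flipped = ⊥-elim (not≢ _ (cong isNeg flipped))
    inFirst : ∀ y g g₁ → Standard bJ DJ LJ g ≡ true → Standard bJ DJ LJ g₁ ≡ true → neg (gen g₁ y) ≡ gen g y →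
              DJ ≡ true × label bJ LJ (proj₁ y) ≡ 0
    inFirst (Fin.zero , c) g g₁ g∈ g₁∈ flipped = let DJ≡true = needs-s1' _ g g₁ g∈ g₁∈ flipped in
      DJ≡true , blockIndex-below bJ LJ (≤-trans (s≤s z≤n) (Shape.2≤b shapeJ DJ≡true))
    inFirst (Fin.suc Fin.zero , c) g g₁ g∈ g₁∈ flipped = let DJ≡true = needs-s1' _ g g₁ g∈ g₁∈ flipped in
      DJ≡true , blockIndex-below bJ LJ (Shape.2≤b shapeJ DJ≡true)
    inFirst (Fin.suc (Fin.suc j) , c) g g₁ _ _ flipped =
      ⊥-elim (not≢ c (trans (cong not (sym (keepsSign g₁))) (trans (cong isNeg flipped) (keepsSign g))))
      where
      keepsSign : ∀ g → isNeg (gen g (Fin.suc (Fin.suc j) , c)) ≡ c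
      keepsSign s1'   = refl
      keepsSign (s k) = refl

  position-firstBlock : ∀ σ {bK DK LK bJ DJ LJ} → Shape bK DK LK → Shape bJ DJ LJ →
    CommutesInto σ (Standard bK DK LK) (Standard bJ DJ LJ) → ∀ t → 0 ≡ label bK LK t → 0 ≡ label bJ LJ (position σ t)
  position-firstBlock σ {bK} {DK} {LK} {bJ} {DJ} {LJ} shapeK shapeJ commutes t 0≡ = sym (begin
    label bJ LJ (position σ t)        ≡⟨ position-sameBlock σ shapeJ commutes t Fin.zero (trans (sym 0≡) (sym label₀)) ⟩
    label bJ LJ (position σ Fin.zero) ≡⟨ proj₂ (position₀-firstBlock σ shapeK shapeJ commutes DK≡true) ⟩
    0                                 ∎)
    where
    open ≡-Reasoning
    DK≡true : DK ≡ true
    DK≡true = label≡0⇒D shapeK t (sym 0≡)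
    label₀ : label bK LK Fin.zero ≡ 0
    label₀ = blockIndex-below bK LK (≤-trans (s≤s z≤n) (Shape.2≤b shapeK DK≡true))

  Shape-D : ∀ {b D D′ L L′} → Shape b D L → Shape b D′ L′ → D ≡ D′
  Shape-D {D = true}  {true}  _ _ = refl
  Shape-D {D = false} {false} _ _ = refl
  Shape-D {D = true}  {false} shape shape′ with Shape.2≤b shape refl | Shape.b≡0 shape′ refl
  ... | 2≤b | refl with 2≤b
  ...   | ()
  Shape-D {D = false} {true}  shape shape′ with Shape.2≤b shape′ refl | Shape.b≡0 shape refl
  ... | 2≤b | refl with 2≤b
  ...   | ()

  -- A block of size c other than block 0 contributes c positions to positionsInBlocksOfSize c.
  blockSize : ℕ → List ℕ → Fin n → ℕ
  blockSize b L t = ℕΣ.sum (δ (label b L t) ∘ label b L)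

  firstBlockSize : ℕ → List ℕ → ℕ
  firstBlockSize b L = ℕΣ.sum (δ 0 ∘ label b L)

  positionsInBlocksOfSize : ℕ → ℕ → List ℕ → ℕ
  positionsInBlocksOfSize c b L = ℕΣ.sum (λ t → if 0 ≡ᵇ label b L t then 0 else δ c (blockSize b L t))

  firstBlockSize-shape : ∀ {b D L} → Shape b D L → firstBlockSize b L ≡ b
  firstBlockSize-shape {b} {L = L} shape =
    trans (∑-blockIndex b L (δ 0) (Shape.total shape) (Shape.positive shape))
          (trans (cong₂ _+_ (*-identityʳ b) (weightedSum-δ₀ L)) (+-identityʳ b))

  positionsInBlocksOfSize-shape : ∀ {b D L} → Shape b D L → ∀ c → positionsInBlocksOfSize c b L ≡ c * multiplicity c L
  positionsInBlocksOfSize-shape {b} {L = L} shape c = begin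
    positionsInBlocksOfSize c b L ≡⟨ ℕΣ.sum-cong-≗ (λ t → cong (count (label b L t)) (size (label b L t))) ⟩
    ℕΣ.sum (countAt ∘ label b L)  ≡⟨ ∑-blockIndex b L countAt total pos ⟩
    b * 0 + weightedSum countAt L ≡⟨ cong (_+ weightedSum countAt L) (*-zeroʳ b) ⟩
    weightedSum countAt L         ≡⟨ weightedSum-multiplicity c L countAt (λ j → cong (δ c) (trans (size-nonfirst j) (weightedSum-δ L j))) ⟩
    c * multiplicity c L          ∎
    where
    open ≡-Reasoning
    total : b + sum L ≡ n
    total = Shape.total shape
    pos : All (1 ≤_) L
    pos = Shape.positive shape
    count : ℕ → ℕ → ℕ
    count v size = if 0 ≡ᵇ v then 0 else δ c size
    countAt : ℕ → ℕ
    countAt v = count v (b * δ v 0 + weightedSum (δ v) L)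
    size : ∀ v → ℕΣ.sum (δ v ∘ label b L) ≡ b * δ v 0 + weightedSum (δ v) L
    size v = ∑-blockIndex b L (δ v) total pos
    size-nonfirst : ∀ j → b * δ (suc j) 0 + weightedSum (δ (suc j)) L ≡ weightedSum (δ (suc j)) L
    size-nonfirst j = cong (_+ weightedSum (δ (suc j)) L) (*-zeroʳ b)

  module Relabelling (π : Permutation′ n) {bK : ℕ} {LK : List ℕ} {bJ : ℕ} {LJ : List ℕ}
    (sameBlock : ∀ t u → label bK LK t ≡ label bK LK u ⇔ label bJ LJ (π ⟨$⟩ʳ t) ≡ label bJ LJ (π ⟨$⟩ʳ u))
    (firstBlock : ∀ t → 0 ≡ label bK LK t ⇔ 0 ≡ label bJ LJ (π ⟨$⟩ʳ t)) where

    ∑-relabel : (f : Fin n → ℕ) → ℕΣ.sum (f ∘ (π ⟨$⟩ʳ_)) ≡ ℕΣ.sum f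
    ∑-relabel f = sym (ℕΣ.∑-permute f π)

    blockSize-relabel : ∀ t → blockSize bK LK t ≡ blockSize bJ LJ (π ⟨$⟩ʳ t)
    blockSize-relabel t = trans (ℕΣ.sum-cong-≗ (λ u → cong bool→ℕ (does-⇔ (sameBlock t u) (_ ≟ℕ _) (_ ≟ℕ _))))
                                (∑-relabel (δ (label bJ LJ (π ⟨$⟩ʳ t)) ∘ label bJ LJ))

    firstBlockSize-relabel : firstBlockSize bK LK ≡ firstBlockSize bJ LJ
    firstBlockSize-relabel = trans (ℕΣ.sum-cong-≗ (λ t → cong bool→ℕ (does-⇔ (firstBlock t) (_ ≟ℕ _) (_ ≟ℕ _))))
                                   (∑-relabel (δ 0 ∘ label bJ LJ))

    positionsInBlocksOfSize-relabel : ∀ c → positionsInBlocksOfSize c bK LK ≡ positionsInBlocksOfSize c bJ LJ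
    positionsInBlocksOfSize-relabel c =
      trans (ℕΣ.sum-cong-≗ (λ t → cong₂ (λ first size → if first then 0 else δ c size)
                                         (does-⇔ (firstBlock t) (_ ≟ℕ _) (_ ≟ℕ _)) (blockSize-relabel t)))
            (∑-relabel (λ t → if 0 ≡ᵇ label bJ LJ t then 0 else δ c (blockSize bJ LJ t)))

  intertwines⇒sameBlocks : ∀ σ {bJ DJ LJ bK DK LK} → Shape bJ DJ LJ → Shape bK DK LK →
    Intertwines 2≤n σ (Standard bJ DJ LJ) (Standard bK DK LK) → bJ ≡ bK × LJ ↭ LK
  intertwines⇒sameBlocks σ {bJ} {DJ} {LJ} {bK} {DK} {LK} shapeJ shapeK i =
    trans (sym (firstBlockSize-shape shapeJ)) (trans (sym R.firstBlockSize-relabel) (firstBlockSize-shape shapeK)) ,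
    multiplicity⇒↭ LJ LK sameMultiplicity
    where
    commutes : CommutesInto σ (Standard bK DK LK) (Standard bJ DJ LJ)
    commutes = intertwines⇒commutesInto σ i
    commutes⁻¹ : CommutesInto (inverse σ) (Standard bJ DJ LJ) (Standard bK DK LK)
    commutes⁻¹ = intertwines⇒commutesInto (inverse σ) (intertwines-inverse 2≤n σ i)
    sameBlock : ∀ t u → label bK LK t ≡ label bK LK u ⇔ label bJ LJ (position σ t) ≡ label bJ LJ (position σ u)
    sameBlock t u = mk⇔ (position-sameBlock σ shapeJ commutes t u)
      (λ same → subst₂ (λ t′ u′ → label bK LK t′ ≡ label bK LK u′) (position-inverse σ t) (position-inverse σ u)
                  (position-sameBlock (inverse σ) shapeK commutes⁻¹ (position σ t) (position σ u) same))
    firstBlock : ∀ t → 0 ≡ label bK LK t ⇔ 0 ≡ label bJ LJ (position σ t)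
    firstBlock t = mk⇔ (position-firstBlock σ shapeK shapeJ commutes t)
      (λ 0≡ → subst (λ t′ → 0 ≡ label bK LK t′) (position-inverse σ t)
                (position-firstBlock (inverse σ) shapeJ shapeK commutes⁻¹ (position σ t) 0≡))
    module R = Relabelling (positionPerm σ) {bK} {LK} {bJ} {LJ} sameBlock firstBlock
    sameMultiplicity : ∀ c → multiplicity c LJ ≡ multiplicity c LK
    sameMultiplicity zero    = trans (multiplicity-0 LJ (Shape.positive shapeJ)) (sym (multiplicity-0 LK (Shape.positive shapeK)))
    sameMultiplicity (suc c) = *-cancelˡ-≡ _ _ (suc c) (begin
      suc c * multiplicity (suc c) LJ   ≡⟨ positionsInBlocksOfSize-shape shapeJ (suc c) ⟨
      positionsInBlocksOfSize (suc c) bJ LJ ≡⟨ R.positionsInBlocksOfSize-relabel (suc c) ⟨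
      positionsInBlocksOfSize (suc c) bK LK ≡⟨ positionsInBlocksOfSize-shape shapeK (suc c) ⟩
      suc c * multiplicity (suc c) LK   ∎)
      where open ≡-Reasoning

  -- Without s_{1'} on either side, σ changes signs on whole blocks of K only, and these all have even size.
  commutesInto⇒even : ∀ σ {LK bJ LJ} → Shape 0 false LK → All (2 ∣_) LK →
    CommutesInto σ (Standard 0 false LK) (Standard bJ false LJ) → signParity σ ≡ false
  commutesInto⇒even σ {LK} {bJ} {LJ} shape evens commutes = begin
    ⊕Σ.sum (sign σ)                   ≡⟨ parity-∑ (sign σ) ⟨
    parity (ℕΣ.sum (bool→ℕ ∘ sign σ)) ≡⟨ cong parity (ℕΣ.sum-cong-≗ (λ i → cong (bool→ℕ ∘ sign σ) (mod-toℕ i))) ⟨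
    parity (ℕΣ.sum {n} (ψ ∘ toℕ))     ≡⟨ cong parity (∑-blockwise {n} 0 LK ψ (Shape.total shape) (liftAdjacent 0 LK (bool→ℕ ∘ sign σ) adjacent)) ⟩
    parity (blockSum ψ 0 LK)          ≡⟨ parity-blockSum ψ LK evens 0 ⟩
    false                             ∎
    where
    open ≡-Reasoning
    ψ : ℕ → ℕ
    ψ t = bool→ℕ (sign σ (t mod n))
    adjacent : ∀ k → blockIndex 0 LK (toℕ k) ≡ blockIndex 0 LK (suc (toℕ k)) →
               bool→ℕ (sign σ (inject₁ k)) ≡ bool→ℕ (sign σ (Fin.suc k))
    adjacent k same with commutes (s k) (sameBlock⇒inStandard 0 false LK k same)
    ... | s1'  , () , _
    ... | s k₂ , _  , c = cong bool→ℕ (sym (trans (cong (λ i → isNeg (to σ (i , false))) (sym (swapFin-left {a = inject₁ k} {Fin.suc k} refl)))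
                                              (cong isNeg (c (inject₁ k , false)))))

  evenBlocks⇒even : ∀ σ {L L′} → Shape 0 false L → All (2 ∣_) L →
    Intertwines 2≤n σ (Standard 0 false L) (Standard 0 false L′) → signParity σ ≡ false
  evenBlocks⇒even σ shape evens i = trans (sym (signParity-inverse σ))
    (commutesInto⇒even (inverse σ) shape evens (intertwines⇒commutesInto (inverse σ) (intertwines-inverse 2≤n σ i)))

  signedConjugate-cong : ∀ {J J′ K K′} → (∀ g → J g ≡ J′ g) → (∀ g → K g ≡ K′ g) →
    SignedConjugate 2≤n J K ⇔ SignedConjugate 2≤n J′ K′
  signedConjugate-cong J≗J′ K≗K′ = mk⇔
    (λ (σ , even , i) → σ , even , intertwines-cong 2≤n σ J≗J′ K≗K′ i)
    (λ (σ , even , i) → σ , even , intertwines-cong 2≤n σ (sym ∘ J≗J′) (sym ∘ K≗K′) i)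

  twist : Bool → SubsetS n → SubsetS n
  twist false U = U
  twist true  U = U ∘ ρ

  -- Conjugating by τ on either side removes the twists at the cost of changing the parity.
  untwist : ∀ a b {U U′} σ → Intertwines 2≤n σ (twist a U) (twist b U′) →
    Σ (SignedPerm n) λ σ′ → signParity σ′ ≡ (a xor signParity σ) xor b × Intertwines 2≤n σ′ U U′
  untwist false false σ i = σ , sym (xor-identityʳ _) , i
  untwist true  false {U} σ i = inverse τ ∘ₛ σ ,
    trans (signParity-∘ (inverse τ) σ) (trans (cong (_xor signParity σ) signParity-τ⁻¹) (sym (xor-identityʳ _))) ,
    intertwines-∘ 2≤n (inverse τ) σ (τ⁻¹-intertwines U) i
  untwist false true  {U′ = U′} σ i = σ ∘ₛ τ ,
    trans (signParity-∘ σ τ) (cong (signParity σ xor_) signParity-τ) ,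
    intertwines-∘ 2≤n σ τ i (τ-intertwines U′)
  untwist true  true  {U} {U′} σ i = (inverse τ ∘ₛ σ) ∘ₛ τ ,
    trans (signParity-∘ (inverse τ ∘ₛ σ) τ)
      (cong₂ _xor_ (trans (signParity-∘ (inverse τ) σ) (cong (_xor signParity σ) signParity-τ⁻¹)) signParity-τ) ,
    intertwines-∘ 2≤n (inverse τ ∘ₛ σ) τ (intertwines-∘ 2≤n (inverse τ) σ (τ⁻¹-intertwines U) i) (τ-intertwines U′)

  offset : Comp n → ℕ
  offset (comp lessN L _) = n ∸ sum L
  offset _                = 0

  hasFirst : Comp n → Bool
  hasFirst (comp lessN _ _) = true
  hasFirst _                = false

  twisted : Comp n → Bool
  twisted (comp bigN' _ _) = true
  twisted _                = false

  untwisted : Comp n → SubsetS n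
  untwisted κ = Standard (offset κ) (hasFirst κ) (parts κ)

  shape : ∀ κ → Shape (offset κ) (hasFirst κ) (parts κ)
  shape (comp lessN L (pos , 2+m≤n)) = record
    { total    = m∸n+n≡m (≤-trans (m≤m+n (sum L) 2) 2+m≤n)
    ; positive = pos
    ; first    = inj₁ (refl , m+n≤o⇒m≤o∸n 2 (subst (_≤ n) (+-comm (sum L) 2) 2+m≤n))
    }
  shape (comp oneN  L (pos , total , _)) = record { total = total ; positive = pos ; first = inj₂ (refl , refl) }
  shape (comp bigN  L (pos , total , _)) = record { total = total ; positive = pos ; first = inj₂ (refl , refl) }
  shape (comp bigN' L (pos , total , _)) = record { total = total ; positive = pos ; first = inj₂ (refl , refl) }

  ∉partialSums : ∀ v b L → v < b → elemℕ v (partialSums b L) ≡ false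
  ∉partialSums v b []       v<b = refl
  ∉partialSums v b (x ∷ xs) v<b rewrite dec-false (b ≟ℕ v) (>⇒≢ v<b) = ∉partialSums v (b + x) xs (≤-trans v<b (m≤m+n b x))

  complement-compSubset : ∀ κ g → not (compSubset κ g) ≡ twist (twisted κ) (untwisted κ) g
  complement-compSubset (comp lessN L _) s1'   = refl
  complement-compSubset (comp lessN L _) (s k) = refl
  complement-compSubset (comp oneN  [] (_ , _ , ())) g
  complement-compSubset (comp oneN  (x ∷ xs) _) s1'   = refl
  complement-compSubset (comp oneN  (x ∷ xs) _) (s k) = refl
  complement-compSubset (comp bigN  [] (_ , _ , ())) g
  complement-compSubset (comp bigN  (x ∷ xs) _) s1'   = refl
  complement-compSubset (comp bigN  (x ∷ xs) _) (s k) = refl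
  complement-compSubset (comp bigN' [] (_ , _ , ())) g
  complement-compSubset (comp bigN' (x ∷ xs) (_ , _ , 2≤x)) s1' = cong not (sym (∉partialSums 1 x xs 2≤x))
  complement-compSubset (comp bigN' (x ∷ xs) _) (s Fin.zero)    = refl
  complement-compSubset (comp bigN' (x ∷ xs) _) (s (Fin.suc k)) = refl

  sameOffset : ∀ κ ν → parts κ ↭ parts ν → offset κ ≡ offset ν
  sameOffset κ ν κ↭ν = +-cancelʳ-≡ (sum (parts ν)) (offset κ) (offset ν)
    (trans (cong (offset κ +_) (sym (sum-↭ κ↭ν))) (trans (Shape.total (shape κ)) (sym (Shape.total (shape ν)))))

  sameHasFirst : ∀ κ ν → parts κ ↭ parts ν → hasFirst κ ≡ hasFirst ν
  sameHasFirst κ ν κ↭ν = Shape-D (shape κ) (subst (λ b → Shape b (hasFirst ν) (parts ν)) (sym (sameOffset κ ν κ↭ν)) (shape ν))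

  untwisted-conjugate : ∀ κ ν → parts κ ↭ parts ν → SignedConjugate 2≤n (untwisted κ) (untwisted ν)
  untwisted-conjugate κ ν κ↭ν =
    subst₂ (λ b D → SignedConjugate 2≤n (untwisted κ) (Standard b D (parts ν))) (sameOffset κ ν κ↭ν) (sameHasFirst κ ν κ↭ν)
      (permuteBlocks (offset κ) (hasFirst κ) [] κ↭ν (Shape.total (shape κ)) (Shape.positive (shape κ)) (Shape.2≤b (shape κ)))

  twistedComplement : Comp n → SubsetS n
  twistedComplement κ = twist (twisted κ) (untwisted κ)

  ≈⇒signedConjugate : ∀ κ ν → κ ≈C ν → SignedConjugate 2≤n (twistedComplement κ) (twistedComplement ν)
  ≈⇒signedConjugate κ@(comp lessN _ _) ν@(comp lessN _ _) (κ↭ν , _) = untwisted-conjugate κ ν κ↭ν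
  ≈⇒signedConjugate κ@(comp lessN _ _) ν@(comp oneN  _ _) (κ↭ν , _) with () ← sameHasFirst κ ν κ↭ν
  ≈⇒signedConjugate κ@(comp lessN _ _) ν@(comp bigN  _ _) (κ↭ν , _) with () ← sameHasFirst κ ν κ↭ν
  ≈⇒signedConjugate κ@(comp lessN _ _) ν@(comp bigN' _ _) (κ↭ν , _) with () ← sameHasFirst κ ν κ↭ν
  ≈⇒signedConjugate κ@(comp oneN  _ _) ν@(comp lessN _ _) (κ↭ν , _) with () ← sameHasFirst κ ν κ↭ν
  ≈⇒signedConjugate κ@(comp bigN  _ _) ν@(comp lessN _ _) (κ↭ν , _) with () ← sameHasFirst κ ν κ↭ν
  ≈⇒signedConjugate κ@(comp bigN' _ _) ν@(comp lessN _ _) (κ↭ν , _) with () ← sameHasFirst κ ν κ↭ν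
  ≈⇒signedConjugate κ@(comp oneN  _ _) ν@(comp oneN  _ _) (κ↭ν , _) = untwisted-conjugate κ ν κ↭ν
  ≈⇒signedConjugate κ@(comp oneN  _ _) ν@(comp bigN  _ _) (κ↭ν , _) = untwisted-conjugate κ ν κ↭ν
  ≈⇒signedConjugate κ@(comp bigN  _ _) ν@(comp oneN  _ _) (κ↭ν , _) = untwisted-conjugate κ ν κ↭ν
  ≈⇒signedConjugate κ@(comp bigN  _ _) ν@(comp bigN  _ _) (κ↭ν , _) = untwisted-conjugate κ ν κ↭ν
  ≈⇒signedConjugate κ@(comp bigN' _ _) ν@(comp bigN' _ _) (κ↭ν , _) = ρ-signedConjugate (untwisted-conjugate κ ν κ↭ν)
  ≈⇒signedConjugate κ@(comp oneN (.1 ∷ xs) (pos , total , refl)) ν@(comp bigN' _ _) (κ↭ν , _) =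
    signedConjugate-trans 2≤n (oddBlock-twist (1 ∷ xs) 0 refl total pos) (ρ-signedConjugate (untwisted-conjugate κ ν κ↭ν))
  ≈⇒signedConjugate κ@(comp bigN Lκ (pos , total , _)) ν@(comp bigN' _ _) (κ↭ν , unobstructed) =
    let (j , odd) = oddBlock Lκ (λ evens → unobstructed (inj₁ (refl , refl , evens))) in
    signedConjugate-trans 2≤n (oddBlock-twist Lκ j odd total pos) (ρ-signedConjugate (untwisted-conjugate κ ν κ↭ν))
  ≈⇒signedConjugate κ@(comp bigN' _ _) ν@(comp oneN (.1 ∷ xs) (pos , total , refl)) (κ↭ν , _) =
    signedConjugate-trans 2≤n (ρ-signedConjugate (untwisted-conjugate κ ν κ↭ν))
      (signedConjugate-sym 2≤n (oddBlock-twist (1 ∷ xs) 0 refl total pos))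
  ≈⇒signedConjugate κ@(comp bigN' _ _) ν@(comp bigN Lν (pos , total , _)) (κ↭ν , unobstructed) =
    let (j , odd) = oddBlock Lν (λ evens → unobstructed (inj₂ (refl , refl , All-resp-↭ (↭-sym κ↭ν) evens))) in
    signedConjugate-trans 2≤n (ρ-signedConjugate (untwisted-conjugate κ ν κ↭ν))
      (signedConjugate-sym 2≤n (oddBlock-twist Lν j odd total pos))

  signedConjugate⇒≈ : ∀ κ ν → SignedConjugate 2≤n (twistedComplement κ) (twistedComplement ν) → κ ≈C ν
  signedConjugate⇒≈ κ ν (σ , even , i) with untwist (twisted κ) (twisted ν) σ i
  ... | σ′ , parity′ , i′ = proj₂ (intertwines⇒sameBlocks σ′ (shape κ) (shape ν) i′) , unobstructed κ ν σ′ parity″ i′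
    where
    parity″ : signParity σ′ ≡ (twisted κ xor false) xor twisted ν
    parity″ = trans parity′ (cong (λ p → (twisted κ xor p) xor twisted ν) even)
    unobstructed : ∀ κ ν σ′ → signParity σ′ ≡ (twisted κ xor false) xor twisted ν →
      Intertwines 2≤n σ′ (untwisted κ) (untwisted ν) → ¬ ((kind κ ≡ bigN × kind ν ≡ bigN' × All Even (parts κ))
                                                         ⊎ (kind κ ≡ bigN' × kind ν ≡ bigN × All Even (parts κ)))
    unobstructed κ@(comp _ _ _) (comp _ _ _) σ′ odd i′ (inj₁ (refl , refl , evens)) =
      not-¬ (evenBlocks⇒even σ′ (shape κ) evens i′) odd
    unobstructed κ@(comp _ _ _) (comp _ _ _) σ′ odd i′ (inj₂ (refl , refl , evens)) =
      not-¬ (evenBlocks⇒even σ′ (shape κ) evens i′) odd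

  signedConjugate⇔≈ : ∀ κ ν → SignedConjugate 2≤n (twistedComplement κ) (twistedComplement ν) ⇔ (κ ≈C ν)
  signedConjugate⇔≈ κ ν = mk⇔ (signedConjugate⇒≈ κ ν) (≈⇒signedConjugate κ ν)

mainTheorem1 : (n : ℕ) (h : 2 ≤ n) (J K : SubsetS n) (κ ν : Comp n) →
    (∀ g → compSubset κ g ≡ complement J g) →
    (∀ g → compSubset ν g ≡ complement K g) →
    (Conjugate h J K ⇔ (κ ≈C ν))
mainTheorem1 (suc (suc m)) (s≤s (s≤s z≤n)) J K κ ν κ↔J ν↔K =
  signedConjugate⇔≈ κ ν ⇔-∘ (signedConjugate-cong (complementOf κ↔J) (complementOf ν↔K) ⇔-∘ conjugate⇔signedConjugate 2≤n)
  where
  complementOf : ∀ {U μ} → (∀ g → compSubset μ g ≡ complement U g) → ∀ g → U g ≡ twistedComplement μ g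
  complementOf {U} {μ} μ↔U g = trans (sym (not-involutive (U g))) (trans (cong not (sym (μ↔U g))) (complement-compSubset μ g))
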